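{- Let $X$ be a nominal set. For every $n\in\mathbb{N}$, the component $e_n\colon M^{\mathsf{loc}}_nX\to\mathcal{P}_{\mathsf{fs}}(\mathbb{A}^n\times X)$ of the homomorphism $e\colon F^{\mathsf{loc}}X\to F'X$ is injective.
   Context: Nominal sets: $\mathbb{A}$ countably infinite set of names, $G$ finite permutations of $\mathbb{A}$, $(a\,b)$ transpositions. Nominal set: set with $G$-action, every element with a finite support; $\mathsf{supp}$ least support, $a\#x$ iff $a\notin\mathsf{supp}(x)$; orbit-finite = finitely many orbits. $[\mathbb{A}]Z$: quotient of $\mathbb{A}\times Z$ by $(a,z)\sim(b,z')$ iff $(c\,a)\cdot z=(c\,b)\cdot z'$ for some fresh $c$, classes $\langle a\rangle z$. $\mathcal{P}_{\mathsf{fs}}$ is the finitely supported powerset. Graded nominal algebra for $T^{\mathsf{loc}}$: signature $\Sigma^{\mathsf{bar}}$ with pure $0$ (constant) and $+$ (binary), both depth 0, free $\mathsf{pre}$ and bound $\mathsf{abs}$, unary of depth 1. Terms over $X$: variables, $0$, $t+u$, $a.\mathsf{pre}(t)$, $\nu a.\mathsf{abs}(t)$; uniform depth: variables $0$, $0$ any depth, $+$ preserves, $\mathsf{pre},\mathsf{abs}$ add 1; $\mathsf{Term}_n(X)$ the nominal set of terms of uniform depth $n$ (raw terms, $\pi$ acting on names and variables). Axioms of $T^{\mathsf{loc}}$ (for each orbit-finite $Y$, $x,y,z\in Y$, $a\in\mathbb{A}$): $Y\vdash_0x+0=x$, $x+x=x$, $x+y=y+x$, $(x+y)+z=x+(y+z)$;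 $Y\vdash_1a.\mathsf{pre}(x+y)=a.\mathsf{pre}(x)+a.\mathsf{pre}(y)$; $\emptyset\vdash_1a.\mathsf{pre}(0)=0$; $Y\vdash_1\nu a.\mathsf{abs}(x+y)=\nu a.\mathsf{abs}(x)+\nu a.\mathsf{abs}(y)$; $\emptyset\vdash_1\nu a.\mathsf{abs}(0)=0$; $Y\vdash_1a.\mathsf{pre}(x)+\nu a.\mathsf{abs}(x)=\nu a.\mathsf{abs}(x)$. Derivable judgements $X\vdash_m t=u$ are the least set closed under (refl) $X\vdash_0x=x$; (symm); (trans); (cong) for each operation (same prefix name); (ax) instantiating an axiom $Y\vdash_m r=s$ as $X\vdash_{m+l}(\tau\cdot r)\sigma=(\tau\cdot s)\sigma$ for $\tau\in G$ and $\sigma\colon Y\to\mathsf{Term}_l(X)$ with $X\vdash_l\pi\cdot\sigma(y)=\sigma(\pi\cdot y)$ derivable for all $\pi,y$ (substitution does not rename bound names); (perm) from $X\vdash_mt=(a\,b)\cdot u$, $a\ne b$, $a\#u$, infer $X\vdash_{m+1}\nu a.\mathsf{abs}(t)=\nu b.\mathsf{abs}(u)$. $M^{\mathsf{loc}}_nX=\mathsf{Term}_n(X)/{\sim}$ with $\sim$ derivable equality in $T^{\mathsf{loc}}$, classes $[t]_n$. $F^{\mathsf{loc}}X$ is the $(\Sigma^{\mathsf{bar}},\omega)$-algebra with carriers $M^{\mathsf{loc}}_nX$ and operations on representatives ($0=[0]$, $[t]+[u]=[t+u]$, $\mathsf{pre}(a,[t])=[a.\mathsf{pre}(t)]$, $\mathsf{abs}(\langle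 a\rangle[t])=[\nu a.\mathsf{abs}(t)]$); it is the free $(T^{\mathsf{loc}},\omega)$-model on $X$. $F'X$: the $(\Sigma^{\mathsf{bar}},\omega)$-algebra with $(F'X)_n=\mathcal{P}_{\mathsf{fs}}(\mathbb{A}^n\times X)$, $0=\emptyset$, $+=\cup$, $\mathsf{pre}(a,L)=\{aw\mid w\in L\}$, $\mathsf{abs}(\langle a\rangle L)=\{bv\mid\langle a\rangle L=\langle a'\rangle L'\text{ in }[\mathbb{A}]\mathcal{P}_{\mathsf{fs}}(\mathbb{A}^n\times X),\ w'\in L',\ \langle a'\rangle w'=\langle b\rangle v\text{ in }[\mathbb{A}](\mathbb{A}^n\times X)\}$; it is a $(T^{\mathsf{loc}},\omega)$-model. $e\colon F^{\mathsf{loc}}X\to F'X$ is the unique homomorphism (family of equivariant maps $e_n$ commuting with all operations) with $e_0([x]_0)=\{x\}$ for $x\in X$. -}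

module Defs where

open import Level using (Level; 0ℓ; _⊔_; Lift) renaming (suc to lsuc)
open import Data.Nat using (ℕ; zero; suc; _+_; _≡ᵇ_)
open import Data.Bool using (if_then_else_)
open import Data.List using (List; []; _∷_; _++_; reverse)
open import Data.List.Membership.Propositional using (_∈_; _∉_)
open import Data.List.Relation.Unary.Any using (Any)
open import Data.Vec using (Vec; []; _∷_) renaming (map to vmap)
open import Data.Product using (Σ; ∃; _×_; _,_)
open import Data.Sum using (_⊎_)
open import Data.Empty using (⊥)
open import Relation.Binary.PropositionalEquality using (_≡_; _≢_)

𝔸 : Set
𝔸 = ℕ

swap : 𝔸 → 𝔸 → 𝔸 → 𝔸
swap a b c = if c ≡ᵇ a then b else (if c ≡ᵇ b then a else c)

-- Finite permutations, presented as finite products of transpositions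
-- (every finite permutation is such a product).  Two presentations
-- denote the same element of G iff their denotations agree.
Perm : Set
Perm = List (𝔸 × 𝔸)

⟦_⟧ : Perm → 𝔸 → 𝔸
⟦ [] ⟧ c = c
⟦ (a , b) ∷ π ⟧ c = swap a b (⟦ π ⟧ c)

-- inverse (transpositions are involutions)
_⁻¹ : Perm → Perm
π ⁻¹ = reverse π

⟨_⇄_⟩ : 𝔸 → 𝔸 → Perm
⟨ a ⇄ b ⟩ = (a , b) ∷ []

Fixes : Perm → List 𝔸 → Set
Fixes π S = ∀ b → b ∈ S → ⟦ π ⟧ b ≡ b

Supports : ∀ {a ℓ} {A : Set a} → (Perm → A → A) → (A → A → Set ℓ) →
           List 𝔸 → A → Set ℓ
Supports act _≈_ S x = ∀ π → Fixes π S → act π x ≈ x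

FinSupp : ∀ {a ℓ} {A : Set a} → (Perm → A → A) → (A → A → Set ℓ) → A → Set ℓ
FinSupp act _≈_ x = ∃ λ (S : List 𝔸) → Supports act _≈_ S x

-- c # x  iff  c ∉ supp x, where supp x is the least finite support,
-- i.e. the intersection of all finite supports of x.
Fresh : ∀ {a ℓ} {A : Set a} → (Perm → A → A) → (A → A → Set ℓ) → 𝔸 → A → Set ℓ
Fresh act _≈_ c x = ∃ λ (S : List 𝔸) → Supports act _≈_ S x × c ∉ S

AbsEq : ∀ {a ℓ} {A : Set a} → (Perm → A → A) → (A → A → Set ℓ) →
        𝔸 → A → 𝔸 → A → Set ℓ
AbsEq act _≈_ a x b y =
  ∃ λ (c : 𝔸) → c ≢ a × c ≢ b × Fresh act _≈_ c x × Fresh act _≈_ c y ×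
                 (act ⟨ c ⇄ a ⟩ x ≈ act ⟨ c ⇄ b ⟩ y)

record Nominal : Set₁ where
  field
    Carrier  : Set
    act      : Perm → Carrier → Carrier
    act-id   : ∀ x → act [] x ≡ x
    act-comp : ∀ π σ x → act (π ++ σ) x ≡ act π (act σ x)
    act-ext  : ∀ π σ → (∀ c → ⟦ π ⟧ c ≡ ⟦ σ ⟧ c) → ∀ x → act π x ≡ act σ x
    finsupp  : ∀ x → FinSupp act _≡_ x
open Nominal public

OrbitFinite : Nominal → Set
OrbitFinite Y = ∃ λ (ys : List (Carrier Y)) →
  ∀ y → Any (λ y' → ∃ λ π → act Y π y' ≡ y) ys

∅N : Nominal
∅N = record
  { Carrier = ⊥ ; act = λ _ x → x
  ; act-id = λ () ; act-comp = λ _ _ () ; act-ext = λ _ _ _ ()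
  ; finsupp = λ () }

infixl 6 _⊕_
data Term (V : Set) : Set where
  var : V → Term V
  `0  : Term V
  _⊕_ : Term V → Term V → Term V
  pre : 𝔸 → Term V → Term V
  abs : 𝔸 → Term V → Term V

-- action on raw terms: on all names (also bound ones) and on variables
actT : ∀ {V : Set} → (Perm → V → V) → Perm → Term V → Term V
actT f π (var x) = var (f π x)
actT f π `0 = `0
actT f π (t ⊕ u) = actT f π t ⊕ actT f π u
actT f π (pre a t) = pre (⟦ π ⟧ a) (actT f π t)
actT f π (abs a t) = abs (⟦ π ⟧ a) (actT f π t)

data Depth {V : Set} : Term V → ℕ → Set where
  d-var : ∀ x → Depth (var x) 0
  d-0   : ∀ n → Depth `0 n
  d-⊕   : ∀ {t u n} → Depth t n → Depth u n → Depth (t ⊕ u) n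
  d-pre : ∀ {t n} a → Depth t n → Depth (pre a t) (suc n)
  d-abs : ∀ {t n} a → Depth t n → Depth (abs a t) (suc n)

-- substitution (does not rename bound names)
subst : ∀ {V W : Set} → (V → Term W) → Term V → Term W
subst σ (var x) = σ x
subst σ `0 = `0
subst σ (t ⊕ u) = subst σ t ⊕ subst σ u
subst σ (pre a t) = pre a (subst σ t)
subst σ (abs a t) = abs a (subst σ t)

-- Axioms of T^loc:  Ax Y m r s  means  Y ⊢_m r = s  is an axiom

data Ax : (Y : Nominal) → ℕ → Term (Carrier Y) → Term (Carrier Y) → Set₁ where
  ax-unit  : ∀ {Y} x → Ax Y 0 (var x ⊕ `0) (var x)
  ax-idem  : ∀ {Y} x → Ax Y 0 (var x ⊕ var x) (var x)
  ax-comm  : ∀ {Y} x y → Ax Y 0 (var x ⊕ var y) (var y ⊕ var x)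
  ax-assoc : ∀ {Y} x y z → Ax Y 0 ((var x ⊕ var y) ⊕ var z) (var x ⊕ (var y ⊕ var z))
  ax-pre⊕  : ∀ {Y} a x y → Ax Y 1 (pre a (var x ⊕ var y)) (pre a (var x) ⊕ pre a (var y))
  ax-pre0  : ∀ a → Ax ∅N 1 (pre a `0) `0
  ax-abs⊕  : ∀ {Y} a x y → Ax Y 1 (abs a (var x ⊕ var y)) (abs a (var x) ⊕ abs a (var y))
  ax-abs0  : ∀ a → Ax ∅N 1 (abs a `0) `0
  ax-preabs : ∀ {Y} a x → Ax Y 1 (pre a (var x) ⊕ abs a (var x)) (abs a (var x))

data Derivable (X : Nominal) : ℕ → Term (Carrier X) → Term (Carrier X) → Set₁ where
  refl  : ∀ x → Derivable X 0 (var x) (var x)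
  symm  : ∀ {m t u} → Derivable X m t u → Derivable X m u t
  trans : ∀ {m t u v} → Derivable X m t u → Derivable X m u v → Derivable X m t v
  cong-0   : ∀ m → Derivable X m `0 `0
  cong-⊕   : ∀ {m t t′ u u′} → Derivable X m t t′ → Derivable X m u u′ →
             Derivable X m (t ⊕ u) (t′ ⊕ u′)
  cong-pre : ∀ {m t u} a → Derivable X m t u → Derivable X (suc m) (pre a t) (pre a u)
  cong-abs : ∀ {m t u} a → Derivable X m t u → Derivable X (suc m) (abs a t) (abs a u)
  ax : ∀ (Y : Nominal) → OrbitFinite Y → ∀ {m r s} → Ax Y m r s →
       ∀ (τ : Perm) (l : ℕ) (σ : Carrier Y → Term (Carrier X)) →
       (∀ y → Depth (σ y) l) →
       (∀ π y → Derivable X l (actT (act X) π (σ y)) (σ (act Y π y))) →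
       Derivable X (m + l) (subst σ (actT (act Y) τ r)) (subst σ (actT (act Y) τ s))
  perm : ∀ {m t u} a b → Derivable X m t (actT (act X) ⟨ a ⇄ b ⟩ u) → a ≢ b →
         Fresh (actT (act X)) _≡_ a u →
         Derivable X (suc m) (abs a t) (abs b u)

-- The algebra F'X:  (F'X)_n = P_fs(𝔸^n × X)
-- subsets of 𝔸^n × X are predicates, at universe level Lvl n
-- (needed because abs quantifies over subsets)

Lvl : ℕ → Level
Lvl zero = 0ℓ
Lvl (suc n) = lsuc (Lvl n)

module F′ (X : Nominal) where
  Elt : ℕ → Set
  Elt n = Vec 𝔸 n × Carrier X

  actE : ∀ {n} → Perm → Elt n → Elt n
  actE π (w , x) = vmap ⟦ π ⟧ w , act X π x

  Sub : ∀ ℓ → ℕ → Set (lsuc ℓ)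
  Sub ℓ n = Elt n → Set ℓ

  actP : ∀ {ℓ n} → Perm → Sub ℓ n → Sub ℓ n
  actP π L p = L (actE (π ⁻¹) p)

  _≐_ : ∀ {ℓ n} → Sub ℓ n → Sub ℓ n → Set ℓ
  L ≐ K = ∀ p → (L p → K p) × (K p → L p)

  zeroF : ∀ {n} → Sub (Lvl n) n
  zeroF _ = Lift _ ⊥

  unionF : ∀ {n} → Sub (Lvl n) n → Sub (Lvl n) n → Sub (Lvl n) n
  unionF L K p = L p ⊎ K p

  preF : ∀ {n} → 𝔸 → Sub (Lvl n) n → Sub (Lvl (suc n)) (suc n)
  preF a L (b ∷ w , x) = Lift _ (b ≡ a × L (w , x))

  absF : ∀ {n} → 𝔸 → Sub (Lvl n) n → Sub (Lvl (suc n)) (suc n)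
  absF {n} a L (b ∷ v , x) =
    ∃ λ (a′ : 𝔸) → ∃ λ (L′ : Sub (Lvl n) n) →
      FinSupp actP _≐_ L′ ×
      AbsEq actP _≐_ a L a′ L′ ×
      ∃ λ (w′ : Elt n) → L′ w′ × AbsEq actE _≡_ a′ w′ b (v , x)

  -- e : F^loc X → F'X, computed on representatives (terms of uniform depth n):
  -- the homomorphism with e₀[x] = {x}
  e : ∀ {t : Term (Carrier X)} {n} → Depth t n → Sub (Lvl n) n
  e (d-var x) ([] , y) = y ≡ x
  e (d-0 n) = zeroF
  e (d-⊕ dt du) = unionF (e dt) (e du)
  e (d-pre a dt) = preF a (e dt)
  e (d-abs a dt) = absF a (e dt)

-- A term of uniform depth is provably equal to a sum of monomials, i.e. of terms built from one
-- variable by prefixes a.pre and binders νa.abs alone, and e sends a monomial to a set containing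
-- its word: its names followed by its variable.  Order terms by t ≤ u iff t + u = u.  The key step
-- is that a monomial m whose word lies in e u satisfies m ≤ u, by induction on the depth and on u:
-- sums and prefixes are matched against the shape of u, a.pre(m) lies below νa.abs(m) by the last
-- axiom, and for νb.abs(m) ≤ νa.abs(u) both binders are renamed by (perm) to a common fresh name,
-- using that membership of a word in an abstraction of F′X can be tested at any fresh name.  This
-- needs the bound names of m to neither shadow outer names nor occur in u, which an α-renaming of
-- t, again by (perm) and respected by e, arranges.  So e t ⊆ e u gives t ≤ u, and e t = e u gives
-- t = u by antisymmetry.

module Submission where

open import Level using (_⊔_; lift) renaming (suc to lsuc)
open import Function using (_∘_; id)
open import Data.Bool using (true; false)
open import Data.Bool.Properties using (T-irrelevant)
open import Data.Empty using (⊥-elim)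
open import Data.Unit using (⊤; tt)
open import Data.Product using (Σ; ∃; _×_; _,_; proj₁; proj₂; zip′) renaming (swap to swap×)
import Data.Product as Prod
open import Data.Sum using (inj₁; inj₂)
import Data.Sum as Sum
open import Data.Nat using (ℕ; zero; suc; _≡ᵇ_; _+_; _≤_)
open import Data.Nat.Properties using (_≟_; suc-injective; ≡-irrelevant; m≤m+n; m≤n+m; <-irrefl)
import Data.Nat.Properties as ℕ
open import Data.Nat.ListAction using (sum)
open import Data.Fin using (Fin; zero; suc)
open import Data.Vec using (Vec; []; _∷_; toList) renaming (map to vmap)
import Data.Vec.Properties as VecP
open import Data.List using (List; []; _∷_; _++_; reverse; map; length; deduplicate; allFin)
open import Data.List.Properties
  using (unfold-reverse; reverse-++; reverse-involutive; map-∘; map-cong; map-id; map-id-local; map-++;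
         length-map; ∷-injective)
open import Data.List.Membership.Propositional using (_∈_; _∉_; lose)
open import Data.List.Membership.Propositional.Properties
  using (∈-++⁺ˡ; ∈-++⁺ʳ; ∈-++⁻; ∈-map⁺; ∈-map⁻; ∈-deduplicate⁺; ∈-allFin)
open import Data.List.Relation.Unary.Any using (here; there)
open import Data.List.Relation.Unary.All using (All; []; _∷_)
import Data.List.Relation.Unary.All as All
import Data.List.Relation.Unary.All.Properties as All
open import Data.List.Relation.Unary.AllPairs using (_∷_)
open import Data.List.Relation.Unary.Unique.Propositional using (Unique)
import Data.List.Relation.Unary.Unique.Propositional.Properties as Unique
open import Data.List.Relation.Unary.Unique.DecPropositional _≟_ using (unique?)
open import Data.List.Relation.Unary.Unique.DecPropositional.Properties using (deduplicate-!)
open import Data.List.Relation.Binary.Disjoint.Propositional using (Disjoint)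
open import Relation.Nullary using (proof; ofʸ; ofⁿ)
open import Relation.Nullary.Decidable using (True; toWitness; fromWitness)
open import Relation.Binary.Bundles using (Setoid)
open import Relation.Binary.Structures using (IsEquivalence)
import Relation.Binary.PropositionalEquality as ≡
open import Relation.Binary.PropositionalEquality
  using (_≡_; _≢_; ≢-sym; refl; sym; trans; cong; cong₂; subst; subst₂; module ≡-Reasoning)
import Relation.Binary.Reasoning.Setoid as SetoidReasoning
import Relation.Binary.Reasoning.Syntax as ReasoningSyntax

open import Defs renaming (subst to substitute; trans to ⊢-trans; symm to ⊢-sym; refl to ⊢-refl)

data SwapView (a b c : 𝔸) : 𝔸 → Set where
  at-left   : c ≡ a → SwapView a b c b
  at-right  : c ≢ a → c ≡ b → SwapView a b c a
  elsewhere : c ≢ a → c ≢ b → SwapView a b c c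

swap-view : ∀ a b c → SwapView a b c (swap a b c)
swap-view a b c with c ≡ᵇ a | proof (c ≟ a)
... | true  | ofʸ c≡a = at-left c≡a
... | false | ofⁿ c≢a with c ≡ᵇ b | proof (c ≟ b)
...   | true  | ofʸ c≡b = at-right c≢a c≡b
...   | false | ofⁿ c≢b = elsewhere c≢a c≢b

swap-left : ∀ a b → swap a b a ≡ b
swap-left a b with swap a b a | swap-view a b a
... | _ | at-left _ = refl
... | _ | at-right a≢a _ = ⊥-elim (a≢a refl)
... | _ | elsewhere a≢a _ = ⊥-elim (a≢a refl)

swap-right : ∀ a b → swap a b b ≡ a
swap-right a b with swap a b b | swap-view a b b
... | _ | at-left refl = refl
... | _ | at-right _ _ = refl
... | _ | elsewhere _ b≢b = ⊥-elim (b≢b refl)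

swap-other : ∀ {a b c} → c ≢ a → c ≢ b → swap a b c ≡ c
swap-other {a} {b} {c} c≢a c≢b with swap a b c | swap-view a b c
... | _ | at-left c≡a = ⊥-elim (c≢a c≡a)
... | _ | at-right _ c≡b = ⊥-elim (c≢b c≡b)
... | _ | elsewhere _ _ = refl

swap-involutive : ∀ a b c → swap a b (swap a b c) ≡ c
swap-involutive a b c with swap a b c | swap-view a b c
... | _ | at-left refl = swap-right c b
... | _ | at-right _ refl = swap-left a c
... | _ | elsewhere c≢a c≢b = swap-other c≢a c≢b

swap-injective : ∀ a b {c d} → swap a b c ≡ swap a b d → c ≡ d
swap-injective a b {c} {d} eq = begin
  c                       ≡⟨ swap-involutive a b c ⟨
  swap a b (swap a b c)   ≡⟨ cong (swap a b) eq ⟩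
  swap a b (swap a b d)   ≡⟨ swap-involutive a b d ⟩
  d                       ∎
  where open ≡-Reasoning

swap-comm : ∀ a b c → swap a b c ≡ swap b a c
swap-comm a b c with swap a b c | swap-view a b c
... | _ | at-left refl = sym (swap-right b c)
... | _ | at-right _ refl = sym (swap-left c a)
... | _ | elsewhere c≢a c≢b = sym (swap-other c≢b c≢a)

swap-conjugate : ∀ p q x y z →
                 swap p q (swap x y z) ≡ swap (swap p q x) (swap p q y) (swap p q z)
swap-conjugate p q x y z with swap x y z | swap-view x y z
... | _ | at-left refl = sym (swap-left (swap p q z) (swap p q y))
... | _ | at-right _ refl = sym (swap-right (swap p q x) (swap p q z))
... | _ | elsewhere z≢x z≢y =
  sym (swap-other (z≢x ∘ swap-injective p q) (z≢y ∘ swap-injective p q))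

swap-swap-rename : ∀ {e f a b} z → a ≢ e → a ≢ f → b ≢ e → b ≢ f →
                   swap e f (swap f a (swap f b z)) ≡ swap e a (swap e b (swap e f z))
swap-swap-rename {e} {f} {a} {b} z a≢e a≢f b≢e b≢f = begin
  swap e f (swap f a (swap f b z))
    ≡⟨ swap-conjugate e f f a (swap f b z) ⟩
  swap (swap e f f) (swap e f a) (swap e f (swap f b z))
    ≡⟨ cong₂ (λ u v → swap u v (swap e f (swap f b z))) (swap-right e f) (swap-other a≢e a≢f) ⟩
  swap e a (swap e f (swap f b z))
    ≡⟨ cong (swap e a) (swap-conjugate e f f b z) ⟩
  swap e a (swap (swap e f f) (swap e f b) (swap e f z))
    ≡⟨ cong₂ (λ u v → swap e a (swap u v (swap e f z))) (swap-right e f) (swap-other b≢e b≢f) ⟩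
  swap e a (swap e b (swap e f z))
    ∎
  where open ≡-Reasoning

⟦⟧-++ : ∀ π σ c → ⟦ π ++ σ ⟧ c ≡ ⟦ π ⟧ (⟦ σ ⟧ c)
⟦⟧-++ [] σ c = refl
⟦⟧-++ ((a , b) ∷ π) σ c = cong (swap a b) (⟦⟧-++ π σ c)

⟦⟧-inverseˡ : ∀ π c → ⟦ π ⁻¹ ⟧ (⟦ π ⟧ c) ≡ c
⟦⟧-inverseˡ [] c = refl
⟦⟧-inverseˡ ((a , b) ∷ π) c = begin
  ⟦ reverse ((a , b) ∷ π) ⟧ (swap a b (⟦ π ⟧ c))
    ≡⟨ cong (λ ρ → ⟦ ρ ⟧ (swap a b (⟦ π ⟧ c))) (unfold-reverse (a , b) π) ⟩
  ⟦ reverse π ++ ⟨ a ⇄ b ⟩ ⟧ (swap a b (⟦ π ⟧ c))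
    ≡⟨ ⟦⟧-++ (reverse π) ⟨ a ⇄ b ⟩ _ ⟩
  ⟦ reverse π ⟧ (swap a b (swap a b (⟦ π ⟧ c)))
    ≡⟨ cong ⟦ reverse π ⟧ (swap-involutive a b _) ⟩
  ⟦ π ⁻¹ ⟧ (⟦ π ⟧ c)
    ≡⟨ ⟦⟧-inverseˡ π c ⟩
  c
    ∎
  where open ≡-Reasoning

⟦⟧-inverseʳ : ∀ π c → ⟦ π ⟧ (⟦ π ⁻¹ ⟧ c) ≡ c
⟦⟧-inverseʳ π c = begin
  ⟦ π ⟧ (⟦ π ⁻¹ ⟧ c)             ≡⟨ cong (λ ρ → ⟦ ρ ⟧ (⟦ π ⁻¹ ⟧ c)) (reverse-involutive π) ⟨
  ⟦ (π ⁻¹) ⁻¹ ⟧ (⟦ π ⁻¹ ⟧ c)     ≡⟨ ⟦⟧-inverseˡ (π ⁻¹) c ⟩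
  c                              ∎
  where open ≡-Reasoning

⟦⟧-injective : ∀ π {c d} → ⟦ π ⟧ c ≡ ⟦ π ⟧ d → c ≡ d
⟦⟧-injective π {c} {d} eq = begin
  c                     ≡⟨ ⟦⟧-inverseˡ π c ⟨
  ⟦ π ⁻¹ ⟧ (⟦ π ⟧ c)    ≡⟨ cong ⟦ π ⁻¹ ⟧ eq ⟩
  ⟦ π ⁻¹ ⟧ (⟦ π ⟧ d)    ≡⟨ ⟦⟧-inverseˡ π d ⟩
  d                     ∎
  where open ≡-Reasoning

⟦⟧-swap : ∀ π x y z → ⟦ π ⟧ (swap x y z) ≡ swap (⟦ π ⟧ x) (⟦ π ⟧ y) (⟦ π ⟧ z)
⟦⟧-swap [] x y z = refl
⟦⟧-swap ((p , q) ∷ π) x y z =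
  trans (cong (swap p q) (⟦⟧-swap π x y z)) (swap-conjugate p q (⟦ π ⟧ x) (⟦ π ⟧ y) (⟦ π ⟧ z))

⟦⟧-inverse-cong : ∀ π σ → (∀ c → ⟦ π ⟧ c ≡ ⟦ σ ⟧ c) → ∀ c → ⟦ π ⁻¹ ⟧ c ≡ ⟦ σ ⁻¹ ⟧ c
⟦⟧-inverse-cong π σ π≗σ c = begin
  ⟦ π ⁻¹ ⟧ c                         ≡⟨ cong ⟦ π ⁻¹ ⟧ (⟦⟧-inverseʳ σ c) ⟨
  ⟦ π ⁻¹ ⟧ (⟦ σ ⟧ (⟦ σ ⁻¹ ⟧ c))      ≡⟨ cong ⟦ π ⁻¹ ⟧ (π≗σ _) ⟨
  ⟦ π ⁻¹ ⟧ (⟦ π ⟧ (⟦ σ ⁻¹ ⟧ c))      ≡⟨ ⟦⟧-inverseˡ π _ ⟩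
  ⟦ σ ⁻¹ ⟧ c                         ∎
  where open ≡-Reasoning

⟦⟧-∉-map : ∀ π {c S} → c ∉ S → ⟦ π ⟧ c ∉ map ⟦ π ⟧ S
⟦⟧-∉-map π c∉S πc∈πS with ∈-map⁻ ⟦ π ⟧ πc∈πS
... | d , d∈S , πc≡πd = c∉S (subst (_∈ _) (sym (⟦⟧-injective π πc≡πd)) d∈S)

∈-map-swap⁻ : ∀ {f a c xs} → c ∈ map (swap f a) xs → c ≢ f → c ≢ a → c ∈ xs
∈-map-swap⁻ {f} {a} {c} c∈ c≢f c≢a with ∈-map⁻ (swap f a) c∈
... | d , d∈xs , c≡fad = subst (_∈ _) d≡c d∈xs
  where
  d≡c : d ≡ c
  d≡c = trans (sym (swap-involutive f a d)) (trans (cong (swap f a) (sym c≡fad)) (swap-other c≢f c≢a))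

map-swap-id : ∀ {f a xs} → f ∉ xs → a ∉ xs → map (swap f a) xs ≡ xs
map-swap-id f∉ a∉ = map-id-local (All.tabulate λ d∈ →
  swap-other (λ d≡f → f∉ (subst (_∈ _) d≡f d∈)) (λ d≡a → a∉ (subst (_∈ _) d≡a d∈)))

∈⇒≤sum : ∀ {c S} → c ∈ S → c ≤ sum S
∈⇒≤sum {c} {_ ∷ S} (here refl) = m≤m+n c (sum S)
∈⇒≤sum {c} {d ∷ S} (there c∈S) = ℕ.≤-trans (∈⇒≤sum c∈S) (m≤n+m (sum S) d)

fresh : List 𝔸 → 𝔸
fresh S = suc (sum S)

fresh-∉ : ∀ S → fresh S ∉ S
fresh-∉ S fresh∈S = <-irrefl refl (∈⇒≤sum fresh∈S)

relabel : List 𝔸 → List 𝔸 → Perm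
relabel [] _ = []
relabel (_ ∷ _) [] = []
relabel (n ∷ N) (c ∷ v) = (c , ⟦ relabel N v ⟧ n) ∷ relabel N v

relabel-maps : ∀ N v → Unique N → Unique v → length v ≡ length N → map ⟦ relabel N v ⟧ N ≡ v
relabel-maps [] [] _ _ _ = refl
relabel-maps (n ∷ N) (c ∷ v) (n∉N ∷ N-unique) (c∉v ∷ v-unique) |v|≡|N| =
  cong₂ _∷_ (swap-right c m) (begin
    map (swap c m ∘ ⟦ ρ ⟧) N     ≡⟨ map-∘ N ⟩
    map (swap c m) (map ⟦ ρ ⟧ N) ≡⟨ cong (map (swap c m)) ρN≡v ⟩
    map (swap c m) v             ≡⟨ map-id-local (All.tabulate fixes) ⟩
    v                            ∎)
  where
  open ≡-Reasoning
  ρ = relabel N v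
  m = ⟦ ρ ⟧ n
  ρN≡v = relabel-maps N v N-unique v-unique (suc-injective |v|≡|N|)
  fixes : ∀ {d} → d ∈ v → swap c m d ≡ d
  fixes d∈v = swap-other (≢-sym (All.lookup c∉v d∈v)) d≢m
    where
    d≢m : _ ≢ m
    d≢m d≡m with ∈-map⁻ ⟦ ρ ⟧ (subst (_ ∈_) (sym ρN≡v) d∈v)
    ... | z , z∈N , d≡ρz = All.lookup n∉N z∈N (⟦⟧-injective ρ (trans (sym d≡m) d≡ρz))

map-≡⇒agree : ∀ {A B : Set} {f g : A → B} xs → map f xs ≡ map g xs → ∀ {x} → x ∈ xs → f x ≡ g x
map-≡⇒agree (_ ∷ _) fxs≡gxs (here refl) = proj₁ (∷-injective fxs≡gxs)
map-≡⇒agree (_ ∷ xs) fxs≡gxs (there x∈xs) = map-≡⇒agree xs (proj₂ (∷-injective fxs≡gxs)) x∈xs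

record IsPermAction {a ℓ} {A : Set a} (_≈_ : A → A → Set ℓ) (α : Perm → A → A) :
                    Set (a ⊔ ℓ) where
  field
    isEquivalence : IsEquivalence _≈_
    α-cong : ∀ π {x y} → x ≈ y → α π x ≈ α π y
    α-++   : ∀ π σ x → α π (α σ x) ≈ α (π ++ σ) x
    α-ext  : ∀ π σ → (∀ c → ⟦ π ⟧ c ≡ ⟦ σ ⟧ c) → ∀ x → α π x ≈ α σ x
    α-id   : ∀ x → α [] x ≈ x

module PermActionProperties {a ℓ} {A : Set a} {_≈_ : A → A → Set ℓ} {α : Perm → A → A}
                            (isPermAction : IsPermAction _≈_ α) where
  open IsPermAction isPermAction public
  open IsEquivalence isEquivalence public
    using () renaming (refl to ≈-refl; sym to ≈-sym; trans to ≈-trans)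

  setoid : Setoid a ℓ
  setoid = record { isEquivalence = isEquivalence }

  open SetoidReasoning setoid

  α-inverseˡ : ∀ π x → α (π ⁻¹) (α π x) ≈ x
  α-inverseˡ π x = begin
    α (π ⁻¹) (α π x)   ≈⟨ α-++ (π ⁻¹) π x ⟩
    α (π ⁻¹ ++ π) x    ≈⟨ α-ext _ [] (λ c → trans (⟦⟧-++ (π ⁻¹) π c) (⟦⟧-inverseˡ π c)) x ⟩
    α [] x             ≈⟨ α-id x ⟩
    x                  ∎

  α-inverseʳ : ∀ π x → α π (α (π ⁻¹) x) ≈ x
  α-inverseʳ π x = begin
    α π (α (π ⁻¹) x)   ≈⟨ α-++ π (π ⁻¹) x ⟩
    α (π ++ π ⁻¹) x    ≈⟨ α-ext _ [] (λ c → trans (⟦⟧-++ π (π ⁻¹) c) (⟦⟧-inverseʳ π c)) x ⟩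
    α [] x             ≈⟨ α-id x ⟩
    x                  ∎

  α-agree-on-support : ∀ {S x} → Supports α _≈_ S x → ∀ π σ →
                       (∀ c → c ∈ S → ⟦ π ⟧ c ≡ ⟦ σ ⟧ c) → α π x ≈ α σ x
  α-agree-on-support {S} {x} S-supp π σ π≗σ = begin
    α π x              ≈⟨ α-cong π (S-supp ρ ρ-fixes) ⟨
    α π (α ρ x)        ≈⟨ α-++ π ρ x ⟩
    α (π ++ ρ) x       ≈⟨ α-ext (π ++ ρ) σ π∘ρ≗σ x ⟩
    α σ x              ∎
    where
    ρ = π ⁻¹ ++ σ
    ρ-fixes : Fixes ρ S
    ρ-fixes c c∈S =
      trans (⟦⟧-++ (π ⁻¹) σ c) (trans (cong ⟦ π ⁻¹ ⟧ (sym (π≗σ c c∈S))) (⟦⟧-inverseˡ π c))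
    π∘ρ≗σ : ∀ c → ⟦ π ++ ρ ⟧ c ≡ ⟦ σ ⟧ c
    π∘ρ≗σ c = trans (⟦⟧-++ π ρ c) (trans (cong ⟦ π ⟧ (⟦⟧-++ (π ⁻¹) σ c)) (⟦⟧-inverseʳ π (⟦ σ ⟧ c)))

  supports-α : ∀ {S x} → Supports α _≈_ S x → ∀ π → Supports α _≈_ (map ⟦ π ⟧ S) (α π x)
  supports-α {S} {x} S-supp π σ σ-fixes = ≈-trans (α-++ σ π x)
    (α-agree-on-support S-supp (σ ++ π) π
      (λ c c∈S → trans (⟦⟧-++ σ π c) (σ-fixes (⟦ π ⟧ c) (∈-map⁺ ⟦ π ⟧ c∈S))))

  supports-resp : ∀ {S x y} → Supports α _≈_ S x → x ≈ y → Supports α _≈_ S y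
  supports-resp S-supp x≈y π π-fixes =
    ≈-trans (α-cong π (≈-sym x≈y)) (≈-trans (S-supp π π-fixes) x≈y)

  fresh-α : ∀ {c x} → Fresh α _≈_ c x → ∀ π → Fresh α _≈_ (⟦ π ⟧ c) (α π x)
  fresh-α (S , S-supp , c∉S) π = map ⟦ π ⟧ S , supports-α S-supp π , ⟦⟧-∉-map π c∉S

  fresh-resp : ∀ {c x y} → Fresh α _≈_ c x → x ≈ y → Fresh α _≈_ c y
  fresh-resp (S , S-supp , c∉S) x≈y = S , supports-resp S-supp x≈y , c∉S

  finSupp-α : ∀ {x} → FinSupp α _≈_ x → ∀ π → FinSupp α _≈_ (α π x)
  finSupp-α (S , S-supp) π = map ⟦ π ⟧ S , supports-α S-supp π

  swap-α-conjugate : ∀ π c a x → α ⟨ ⟦ π ⟧ c ⇄ ⟦ π ⟧ a ⟩ (α π x) ≈ α π (α ⟨ c ⇄ a ⟩ x)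
  swap-α-conjugate π c a x = begin
    α ⟨ ⟦ π ⟧ c ⇄ ⟦ π ⟧ a ⟩ (α π x)   ≈⟨ α-++ _ π x ⟩
    α (⟨ ⟦ π ⟧ c ⇄ ⟦ π ⟧ a ⟩ ++ π) x  ≈⟨ α-ext _ _ (sym ∘ conjugate) x ⟩
    α (π ++ ⟨ c ⇄ a ⟩) x              ≈⟨ α-++ π _ x ⟨
    α π (α ⟨ c ⇄ a ⟩ x)               ∎
    where
    conjugate : ∀ z → ⟦ π ++ ⟨ c ⇄ a ⟩ ⟧ z ≡ swap (⟦ π ⟧ c) (⟦ π ⟧ a) (⟦ π ⟧ z)
    conjugate z = trans (⟦⟧-++ π ⟨ c ⇄ a ⟩ z) (⟦⟧-swap π c a z)

  absEq-α : ∀ {a x b y} → AbsEq α _≈_ a x b y → ∀ π →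
            AbsEq α _≈_ (⟦ π ⟧ a) (α π x) (⟦ π ⟧ b) (α π y)
  absEq-α {a} {x} {b} {y} (c , c≢a , c≢b , c#x , c#y , x≈y) π =
    ⟦ π ⟧ c , c≢a ∘ ⟦⟧-injective π , c≢b ∘ ⟦⟧-injective π , fresh-α c#x π , fresh-α c#y π ,
    (begin
      α ⟨ ⟦ π ⟧ c ⇄ ⟦ π ⟧ a ⟩ (α π x)   ≈⟨ swap-α-conjugate π c a x ⟩
      α π (α ⟨ c ⇄ a ⟩ x)               ≈⟨ α-cong π x≈y ⟩
      α π (α ⟨ c ⇄ b ⟩ y)               ≈⟨ swap-α-conjugate π c b y ⟨
      α ⟨ ⟦ π ⟧ c ⇄ ⟦ π ⟧ b ⟩ (α π y)   ∎)

  absEq-resp : ∀ {a x b y x′ y′} → AbsEq α _≈_ a x b y → x ≈ x′ → y ≈ y′ →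
               AbsEq α _≈_ a x′ b y′
  absEq-resp (c , c≢a , c≢b , c#x , c#y , x≈y) x≈x′ y≈y′ =
    c , c≢a , c≢b , fresh-resp c#x x≈x′ , fresh-resp c#y y≈y′ ,
    ≈-trans (α-cong _ (≈-sym x≈x′)) (≈-trans x≈y (α-cong _ y≈y′))

  swap-fresh : ∀ {S x c e} → Supports α _≈_ S x → c ∉ S → e ∉ S → α ⟨ c ⇄ e ⟩ x ≈ x
  swap-fresh S-supp c∉S e∉S = S-supp _ λ b b∈S →
    swap-other (λ b≡c → c∉S (subst (_∈ _) b≡c b∈S)) (λ b≡e → e∉S (subst (_∈ _) b≡e b∈S))

  swap-rename : ∀ {S x c e a} → Supports α _≈_ S x → c ∉ S → e ∉ S → a ≢ c → a ≢ e →
                α ⟨ c ⇄ e ⟩ (α ⟨ c ⇄ a ⟩ x) ≈ α ⟨ e ⇄ a ⟩ x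
  swap-rename {S} {x} {c} {e} {a} S-supp c∉S e∉S a≢c a≢e = begin
    α ⟨ c ⇄ e ⟩ (α ⟨ c ⇄ a ⟩ x)      ≈⟨ α-++ _ _ x ⟩
    α (⟨ c ⇄ e ⟩ ++ ⟨ c ⇄ a ⟩) x     ≈⟨ α-ext _ _ conjugate x ⟩
    α (⟨ e ⇄ a ⟩ ++ ⟨ c ⇄ e ⟩) x     ≈⟨ α-++ _ _ x ⟨
    α ⟨ e ⇄ a ⟩ (α ⟨ c ⇄ e ⟩ x)      ≈⟨ α-cong _ (swap-fresh S-supp c∉S e∉S) ⟩
    α ⟨ e ⇄ a ⟩ x                    ∎
    where
    conjugate : ∀ z → ⟦ ⟨ c ⇄ e ⟩ ++ ⟨ c ⇄ a ⟩ ⟧ z ≡ ⟦ ⟨ e ⇄ a ⟩ ++ ⟨ c ⇄ e ⟩ ⟧ z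
    conjugate z = trans (swap-conjugate c e c a z)
      (cong₂ (λ u v → swap u v (swap c e z)) (swap-left c e) (swap-other a≢c a≢e))

  absEq-names : ∀ {a x b y} → AbsEq α _≈_ a x b y → List 𝔸
  absEq-names (_ , _ , _ , (S , _) , (T , _) , _) = S ++ T

  absEq-any : ∀ {a x b y} (a≈b : AbsEq α _≈_ a x b y) → ∀ e → e ∉ absEq-names a≈b →
              e ≢ a → e ≢ b → α ⟨ e ⇄ a ⟩ x ≈ α ⟨ e ⇄ b ⟩ y
  absEq-any {a} {x} {b} {y} (c , c≢a , c≢b , (S , S-supp , c∉S) , (T , T-supp , c∉T) , x≈y)
            e e∉ e≢a e≢b = begin
    α ⟨ e ⇄ a ⟩ x
      ≈⟨ swap-rename S-supp c∉S (e∉ ∘ ∈-++⁺ˡ) (c≢a ∘ sym) (e≢a ∘ sym) ⟨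
    α ⟨ c ⇄ e ⟩ (α ⟨ c ⇄ a ⟩ x)
      ≈⟨ α-cong _ x≈y ⟩
    α ⟨ c ⇄ e ⟩ (α ⟨ c ⇄ b ⟩ y)
      ≈⟨ swap-rename T-supp c∉T (e∉ ∘ ∈-++⁺ʳ S) (c≢b ∘ sym) (e≢b ∘ sym) ⟩
    α ⟨ e ⇄ b ⟩ y
      ∎

module _ (X : Nominal) where

  open F′ X

  private
    V = Carrier X

  actX-isPermAction : IsPermAction _≡_ (act X)
  actX-isPermAction = record
    { isEquivalence = ≡.isEquivalence
    ; α-cong = λ π → cong (act X π)
    ; α-++ = λ π σ x → sym (act-comp X π σ x)
    ; α-ext = act-ext X
    ; α-id = act-id X
    }

  actT-++ : ∀ π σ (t : Term V) → actT (act X) π (actT (act X) σ t) ≡ actT (act X) (π ++ σ) t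
  actT-++ π σ (var x) = cong var (sym (act-comp X π σ x))
  actT-++ π σ `0 = refl
  actT-++ π σ (t ⊕ u) = cong₂ _⊕_ (actT-++ π σ t) (actT-++ π σ u)
  actT-++ π σ (pre a t) = cong₂ pre (sym (⟦⟧-++ π σ a)) (actT-++ π σ t)
  actT-++ π σ (abs a t) = cong₂ abs (sym (⟦⟧-++ π σ a)) (actT-++ π σ t)

  actT-ext : ∀ π σ → (∀ c → ⟦ π ⟧ c ≡ ⟦ σ ⟧ c) →
             ∀ (t : Term V) → actT (act X) π t ≡ actT (act X) σ t
  actT-ext π σ π≗σ (var x) = cong var (act-ext X π σ π≗σ x)
  actT-ext π σ π≗σ `0 = refl
  actT-ext π σ π≗σ (t ⊕ u) = cong₂ _⊕_ (actT-ext π σ π≗σ t) (actT-ext π σ π≗σ u)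
  actT-ext π σ π≗σ (pre a t) = cong₂ pre (π≗σ a) (actT-ext π σ π≗σ t)
  actT-ext π σ π≗σ (abs a t) = cong₂ abs (π≗σ a) (actT-ext π σ π≗σ t)

  actT-id : ∀ (t : Term V) → actT (act X) [] t ≡ t
  actT-id (var x) = cong var (act-id X x)
  actT-id `0 = refl
  actT-id (t ⊕ u) = cong₂ _⊕_ (actT-id t) (actT-id u)
  actT-id (pre a t) = cong (pre a) (actT-id t)
  actT-id (abs a t) = cong (abs a) (actT-id t)

  actT-isPermAction : IsPermAction _≡_ (actT (act X))
  actT-isPermAction = record
    { isEquivalence = ≡.isEquivalence
    ; α-cong = λ π → cong (actT (act X) π)
    ; α-++ = actT-++
    ; α-ext = actT-ext
    ; α-id = actT-id
    }

  actE-++ : ∀ {n} π σ (w : Elt n) → actE π (actE σ w) ≡ actE (π ++ σ) w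
  actE-++ π σ (v , x) =
    cong₂ _,_ (trans (sym (VecP.map-∘ ⟦ π ⟧ ⟦ σ ⟧ v)) (VecP.map-cong (sym ∘ ⟦⟧-++ π σ) v))
              (sym (act-comp X π σ x))

  actE-ext : ∀ {n} π σ → (∀ c → ⟦ π ⟧ c ≡ ⟦ σ ⟧ c) → ∀ (w : Elt n) → actE π w ≡ actE σ w
  actE-ext π σ π≗σ (v , x) = cong₂ _,_ (VecP.map-cong π≗σ v) (act-ext X π σ π≗σ x)

  actE-isPermAction : ∀ {n} → IsPermAction _≡_ (actE {n})
  actE-isPermAction = record
    { isEquivalence = ≡.isEquivalence
    ; α-cong = λ π → cong (actE π)
    ; α-++ = actE-++
    ; α-ext = actE-ext
    ; α-id = λ { (v , x) → cong₂ _,_ (VecP.map-id v) (act-id X x) }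
    }

  ≐-isEquivalence : ∀ {ℓ n} → IsEquivalence (_≐_ {ℓ} {n})
  ≐-isEquivalence = record
    { refl = λ p → id , id
    ; sym = λ L≐K p → swap× (L≐K p)
    ; trans = λ L≐K K≐M p → zip′ (λ f g → g ∘ f) (λ f g → f ∘ g) (L≐K p) (K≐M p)
    }

  actP-isPermAction : ∀ {ℓ n} → IsPermAction _≐_ (actP {ℓ} {n})
  actP-isPermAction = record
    { isEquivalence = ≐-isEquivalence
    ; α-cong = λ π L≐K p → L≐K _
    ; α-++ = λ π σ L p → ≡⇒⇔ L (trans (actE-++ (σ ⁻¹) (π ⁻¹) p)
                                  (actE-ext _ _ (λ c → cong (λ ρ → ⟦ ρ ⟧ c) (sym (reverse-++ π σ))) p))
    ; α-ext = λ π σ π≗σ L p → ≡⇒⇔ L (actE-ext _ _ (⟦⟧-inverse-cong π σ π≗σ) p)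
    ; α-id = λ L p → ≡⇒⇔ L (IsPermAction.α-id actE-isPermAction p)
    }
    where
    ≡⇒⇔ : ∀ {ℓ n} (L : Sub ℓ n) {p q} → p ≡ q → (L p → L q) × (L q → L p)
    ≡⇒⇔ L refl = id , id

  module ActX = PermActionProperties actX-isPermAction
  module ActT = PermActionProperties actT-isPermAction
  module ActE {n} = PermActionProperties (actE-isPermAction {n})
  module ActP {ℓ n} = PermActionProperties (actP-isPermAction {ℓ} {n})

  -- A support of t: its names together with a support of each variable.  Unlike names below,
  -- supp is not equivariant, since the supports of variables are chosen by finsupp.
  supp : Term V → List 𝔸
  supp (var x) = proj₁ (finsupp X x)
  supp `0 = []
  supp (t ⊕ u) = supp t ++ supp u
  supp (pre a t) = a ∷ supp t
  supp (abs a t) = a ∷ supp t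

  supp-supports : ∀ t → Supports (actT (act X)) _≡_ (supp t) t
  supp-supports (var x) π π-fixes = cong var (proj₂ (finsupp X x) π π-fixes)
  supp-supports `0 π π-fixes = refl
  supp-supports (t ⊕ u) π π-fixes =
    cong₂ _⊕_ (supp-supports t π (λ b → π-fixes b ∘ ∈-++⁺ˡ))
              (supp-supports u π (λ b → π-fixes b ∘ ∈-++⁺ʳ (supp t)))
  supp-supports (pre a t) π π-fixes =
    cong₂ pre (π-fixes a (here refl)) (supp-supports t π (λ b → π-fixes b ∘ there))
  supp-supports (abs a t) π π-fixes =
    cong₂ abs (π-fixes a (here refl)) (supp-supports t π (λ b → π-fixes b ∘ there))

  supp-fresh : ∀ {c} t → c ∉ supp t → Fresh (actT (act X)) _≡_ c t
  supp-fresh t c∉ = supp t , supp-supports t , c∉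

  eltSupp : ∀ {n} → Elt n → List 𝔸
  eltSupp (v , x) = toList v ++ proj₁ (finsupp X x)

  eltSupp-supports : ∀ {n} (w : Elt n) → Supports actE _≡_ (eltSupp w) w
  eltSupp-supports (v , x) π π-fixes =
    cong₂ _,_ (vec-fixed v (λ b → π-fixes b ∘ ∈-++⁺ˡ))
              (proj₂ (finsupp X x) π (λ b → π-fixes b ∘ ∈-++⁺ʳ (toList v)))
    where
    vec-fixed : ∀ {n} (v : Vec 𝔸 n) → Fixes π (toList v) → vmap ⟦ π ⟧ v ≡ v
    vec-fixed [] _ = refl
    vec-fixed (a ∷ v) fixes = cong₂ _∷_ (fixes a (here refl)) (vec-fixed v (λ b → fixes b ∘ there))

  Depth-act : ∀ π {t : Term V} {n} → Depth t n → Depth (actT (act X) π t) n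
  Depth-act π (d-var x) = d-var _
  Depth-act π (d-0 n) = d-0 n
  Depth-act π (d-⊕ dt du) = d-⊕ (Depth-act π dt) (Depth-act π du)
  Depth-act π (d-pre a dt) = d-pre _ (Depth-act π dt)
  Depth-act π (d-abs a dt) = d-abs _ (Depth-act π dt)

  Depth-irrelevant : ∀ {t : Term V} {n} (dt dt′ : Depth t n) → dt ≡ dt′
  Depth-irrelevant (d-var x) (d-var .x) = refl
  Depth-irrelevant (d-0 n) (d-0 .n) = refl
  Depth-irrelevant (d-⊕ dt du) (d-⊕ dt′ du′) =
    cong₂ d-⊕ (Depth-irrelevant dt dt′) (Depth-irrelevant du du′)
  Depth-irrelevant (d-pre a dt) (d-pre .a dt′) = cong (d-pre a) (Depth-irrelevant dt dt′)
  Depth-irrelevant (d-abs a dt) (d-abs .a dt′) = cong (d-abs a) (Depth-irrelevant dt dt′)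

  e-resp : ∀ {t t′ : Term V} {n} → t ≡ t′ → (dt : Depth t n) (dt′ : Depth t′ n) →
           e dt ≐ e dt′
  e-resp refl dt dt′ rewrite Depth-irrelevant dt dt′ = ActP.≈-refl

  unionF-cong : ∀ {n} {L K L′ K′ : Sub (Lvl n) n} → L ≐ L′ → K ≐ K′ → unionF L K ≐ unionF L′ K′
  unionF-cong L≐L′ K≐K′ p =
    Sum.map (proj₁ (L≐L′ p)) (proj₁ (K≐K′ p)) , Sum.map (proj₂ (L≐L′ p)) (proj₂ (K≐K′ p))

  preF-cong : ∀ {n} a {L K : Sub (Lvl n) n} → L ≐ K → preF a L ≐ preF a K
  preF-cong a L≐K (b ∷ v , x) = (λ { (lift (b≡a , p∈L)) → lift (b≡a , proj₁ (L≐K _) p∈L) })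
                              , (λ { (lift (b≡a , p∈K)) → lift (b≡a , proj₂ (L≐K _) p∈K) })

  absF-mono : ∀ {n} a {L K : Sub (Lvl n) n} → L ≐ K → ∀ p → absF a L p → absF a K p
  absF-mono a L≐K (b ∷ v , x) (a′ , L′ , L′-fs , aL≈a′L′ , w′ , w′∈L′ , a′w′≈bvx) =
    a′ , L′ , L′-fs , ActP.absEq-resp aL≈a′L′ L≐K ActP.≈-refl , w′ , w′∈L′ , a′w′≈bvx

  absF-cong : ∀ {n} a {L K : Sub (Lvl n) n} → L ≐ K → absF a L ≐ absF a K
  absF-cong a L≐K p = absF-mono a L≐K p , absF-mono a (ActP.≈-sym L≐K) p

  absF-act⊆ : ∀ {n} π a (L : Sub (Lvl n) n) p →
              actP π (absF a L) p → absF (⟦ π ⟧ a) (actP π L) p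
  absF-act⊆ π a L (b ∷ v , x) (a′ , L′ , L′-fs , aL≈a′L′ , w′ , w′∈L′ , a′w′≈bvx) =
    ⟦ π ⟧ a′ , actP π L′ , ActP.finSupp-α L′-fs π , ActP.absEq-α aL≈a′L′ π , actE π w′ ,
    subst L′ (sym (ActE.α-inverseˡ π w′)) w′∈L′ ,
    subst₂ (AbsEq actE _≡_ (⟦ π ⟧ a′) (actE π w′)) (⟦⟧-inverseʳ π b) (ActE.α-inverseʳ π (v , x))
           (ActE.absEq-α a′w′≈bvx π)

  absF-equivariant : ∀ {n} π a (L : Sub (Lvl n) n) →
                     actP π (absF a L) ≐ absF (⟦ π ⟧ a) (actP π L)
  absF-equivariant π a L p = absF-act⊆ π a L p , ⊇
    where
    q = actE (π ⁻¹) p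
    π⁻¹⁻¹q≡p : actE ((π ⁻¹) ⁻¹) q ≡ p
    π⁻¹⁻¹q≡p = trans (actE-ext _ π (λ c → cong (λ ρ → ⟦ ρ ⟧ c) (reverse-involutive π)) q)
                     (ActE.α-inverseʳ π p)
    ⊇ : absF (⟦ π ⟧ a) (actP π L) p → absF a L q
    ⊇ p∈ = absF-mono a (ActP.α-inverseˡ π L) q
             (subst (λ c → absF c (actP (π ⁻¹) (actP π L)) q) (⟦⟧-inverseˡ π a)
               (absF-act⊆ (π ⁻¹) (⟦ π ⟧ a) (actP π L) q
                 (subst (absF (⟦ π ⟧ a) (actP π L)) (sym π⁻¹⁻¹q≡p) p∈)))

  e-equivariant : ∀ π {t : Term V} {n} (dt : Depth t n) → e (Depth-act π dt) ≐ actP π (e dt)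
  e-equivariant π (d-var x) ([] , y) =
    (λ y≡πx → trans (cong (act X (π ⁻¹)) y≡πx) (ActX.α-inverseˡ π x)) ,
    (λ π⁻¹y≡x → trans (sym (ActX.α-inverseʳ π y)) (cong (act X π) π⁻¹y≡x))
  e-equivariant π (d-0 n) = ActP.≈-refl
  e-equivariant π (d-⊕ dt du) = unionF-cong (e-equivariant π dt) (e-equivariant π du)
  e-equivariant π (d-pre a dt) (b ∷ v , x) with e-equivariant π dt (v , x)
  ... | ⊆ , ⊇ =
    (λ { (lift (b≡πa , w∈)) → lift (trans (cong ⟦ π ⁻¹ ⟧ b≡πa) (⟦⟧-inverseˡ π a) , ⊆ w∈) }) ,
    (λ { (lift (π⁻¹b≡a , w∈)) → lift (trans (sym (⟦⟧-inverseʳ π b)) (cong ⟦ π ⟧ π⁻¹b≡a) , ⊇ w∈) })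
  e-equivariant π (d-abs a dt) =
    ActP.≈-trans (absF-cong (⟦ π ⟧ a) (e-equivariant π dt)) (ActP.≈-sym (absF-equivariant π a (e dt)))

  e-supported : ∀ {t : Term V} {n} (dt : Depth t n) → Supports actP _≐_ (supp t) (e dt)
  e-supported {t} dt π π-fixes =
    ActP.≈-trans (ActP.≈-sym (e-equivariant π dt))
                 (e-resp (supp-supports t π π-fixes) (Depth-act π dt) dt)

  absF-intro : ∀ {n} a {S} {L : Sub (Lvl n) n} → Supports actP _≐_ S L → ∀ {v x} →
               L (v , x) → absF a L (a ∷ v , x)
  absF-intro a {S} {L} S-supp {v} {x} vx∈L =
    a , L , (S , S-supp) , (c , c≢a , c≢a , c#L , c#L , ActP.≈-refl) ,
    (v , x) , vx∈L , (d , d≢a , d≢a , d#vx , d#vx , refl)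
    where
    c = fresh (a ∷ S)
    c≢a : c ≢ a
    c≢a = fresh-∉ (a ∷ S) ∘ here
    c#L : Fresh actP _≐_ c L
    c#L = S , S-supp , fresh-∉ (a ∷ S) ∘ there
    d = fresh (a ∷ eltSupp (v , x))
    d≢a : d ≢ a
    d≢a = fresh-∉ (a ∷ eltSupp (v , x)) ∘ here
    d#vx : Fresh actE _≡_ d (v , x)
    d#vx = eltSupp (v , x) , eltSupp-supports (v , x) , fresh-∉ (a ∷ eltSupp (v , x)) ∘ there

  absF-names : ∀ {n} {a} {L : Sub (Lvl n) n} {b v x} → absF a L (b ∷ v , x) → List 𝔸
  absF-names (a′ , _ , _ , aL≈a′L′ , _ , _ , a′w′≈bvx) =
    a′ ∷ ActP.absEq-names aL≈a′L′ ++ ActE.absEq-names a′w′≈bvx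

  absF-elim-any : ∀ {n} {a} {L : Sub (Lvl n) n} {b v x} (h : absF a L (b ∷ v , x)) →
                  ∀ e → e ∉ absF-names h → e ≢ a → e ≢ b →
                  L (actE ⟨ e ⇄ a ⟩ (actE ⟨ e ⇄ b ⟩ (v , x)))
  absF-elim-any {a = a} {L} {b} {v} {x} (a′ , L′ , _ , aL≈a′L′ , w′ , w′∈L′ , a′w′≈bvx)
                e e∉ e≢a e≢b =
    subst (λ w → L (actE ⟨ e ⇄ a ⟩ w)) ea′w′≡ebvx
      (proj₂ (eaL≐ea′L′ (actE ⟨ e ⇄ a′ ⟩ w′)) (subst L′ (sym (ActE.α-inverseˡ ⟨ e ⇄ a′ ⟩ w′)) w′∈L′))
    where
    N₁ = ActP.absEq-names aL≈a′L′
    eaL≐ea′L′ : actP ⟨ e ⇄ a ⟩ L ≐ actP ⟨ e ⇄ a′ ⟩ L′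
    eaL≐ea′L′ = ActP.absEq-any aL≈a′L′ e (e∉ ∘ there ∘ ∈-++⁺ˡ) e≢a (e∉ ∘ here)
    ea′w′≡ebvx : actE ⟨ e ⇄ a′ ⟩ w′ ≡ actE ⟨ e ⇄ b ⟩ (v , x)
    ea′w′≡ebvx = ActE.absEq-any a′w′≈bvx e (e∉ ∘ there ∘ ∈-++⁺ʳ N₁) (e∉ ∘ here) e≢b

  swap-swap-any : ∀ {n} {S T} {L : Sub (Lvl n) n} {w : Elt n} → Supports actP _≐_ S L →
                  Supports actE _≡_ T w → ∀ {a b e f} → e ∉ S ++ T → f ∉ S ++ T →
                  a ≢ e → a ≢ f → b ≢ e → b ≢ f →
                  L (actE ⟨ e ⇄ a ⟩ (actE ⟨ e ⇄ b ⟩ w)) → L (actE ⟨ f ⇄ a ⟩ (actE ⟨ f ⇄ b ⟩ w))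
  swap-swap-any {S = S} {T} {L} {w} S-supp T-supp {a} {b} {e} {f} e∉ f∉ a≢e a≢f b≢e b≢f
                ea-eb-w∈L =
    proj₁ (ActP.swap-fresh S-supp (e∉ ∘ ∈-++⁺ˡ) (f∉ ∘ ∈-++⁺ˡ) _)
      (subst L (sym ef-fa-fb-w≡ea-eb-w) ea-eb-w∈L)
    where
    open ≡-Reasoning
    ef-fa-fb-w≡ea-eb-w :
      actE ⟨ e ⇄ f ⟩ (actE ⟨ f ⇄ a ⟩ (actE ⟨ f ⇄ b ⟩ w)) ≡ actE ⟨ e ⇄ a ⟩ (actE ⟨ e ⇄ b ⟩ w)
    ef-fa-fb-w≡ea-eb-w = begin
      actE ⟨ e ⇄ f ⟩ (actE ⟨ f ⇄ a ⟩ (actE ⟨ f ⇄ b ⟩ w))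
        ≡⟨ trans (cong (actE _) (actE-++ _ _ w)) (actE-++ _ _ w) ⟩
      actE (⟨ e ⇄ f ⟩ ++ ⟨ f ⇄ a ⟩ ++ ⟨ f ⇄ b ⟩) w
        ≡⟨ actE-ext _ _ (λ z → swap-swap-rename z a≢e a≢f b≢e b≢f) w ⟩
      actE (⟨ e ⇄ a ⟩ ++ ⟨ e ⇄ b ⟩ ++ ⟨ e ⇄ f ⟩) w
        ≡⟨ trans (sym (actE-++ _ _ w)) (cong (actE _) (sym (actE-++ _ _ w))) ⟩
      actE ⟨ e ⇄ a ⟩ (actE ⟨ e ⇄ b ⟩ (actE ⟨ e ⇄ f ⟩ w))
        ≡⟨ cong (actE ⟨ e ⇄ a ⟩ ∘ actE ⟨ e ⇄ b ⟩)
                (ActE.swap-fresh T-supp (e∉ ∘ ∈-++⁺ʳ S) (f∉ ∘ ∈-++⁺ʳ S)) ⟩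
      actE ⟨ e ⇄ a ⟩ (actE ⟨ e ⇄ b ⟩ w)
        ∎

  absF-elim : ∀ {n} {a} {S} {L : Sub (Lvl n) n} → Supports actP _≐_ S L →
              ∀ {b v x T} → Supports actE _≡_ T (v , x) → ∀ {f} → f ∉ S ++ T → f ≢ a → f ≢ b →
              absF a L (b ∷ v , x) → L (actE ⟨ f ⇄ a ⟩ (actE ⟨ f ⇄ b ⟩ (v , x)))
  absF-elim {a = a} {S} S-supp {b} {T = T} T-supp {f} f∉ f≢a f≢b h =
    swap-swap-any S-supp T-supp g∉S++T f∉ (≢-sym g≢a) (≢-sym f≢a) (≢-sym g≢b) (≢-sym f≢b)
      (absF-elim-any h g (g∉ ∘ there ∘ there ∘ there ∘ ∈-++⁺ʳ (S ++ T)) g≢a g≢b)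
    where
    avoid = a ∷ b ∷ f ∷ (S ++ T) ++ absF-names h
    g = fresh avoid
    g∉ = fresh-∉ avoid
    g≢a : g ≢ a
    g≢a = g∉ ∘ here
    g≢b : g ≢ b
    g≢b = g∉ ∘ there ∘ here
    g∉S++T : g ∉ S ++ T
    g∉S++T = g∉ ∘ there ∘ there ∘ there ∘ ∈-++⁺ˡ

  absF-rename⊇ : ∀ {n} {a f S} {L : Sub (Lvl n) n} → Supports actP _≐_ S L → f ∉ S → f ≢ a →
                 ∀ p → absF f (actP ⟨ f ⇄ a ⟩ L) p → absF a L p
  absF-rename⊇ {a = a} {f} {S} {L} S-supp f∉S f≢a (b ∷ v , x)
    (a′ , L′ , (S′ , S′-supp) , fK≈a′L′ , w′ , w′∈L′ , a′w′≈bvx) =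
    a′ , L′ , (S′ , S′-supp) , aL≈a′L′ , w′ , w′∈L′ , a′w′≈bvx
    where
    avoid = a ∷ f ∷ a′ ∷ S ++ S′ ++ ActP.absEq-names fK≈a′L′
    g = fresh avoid
    g∉ = fresh-∉ avoid
    g∉S : g ∉ S
    g∉S = g∉ ∘ there ∘ there ∘ there ∘ ∈-++⁺ˡ
    gfK≐ga′L′ : actP ⟨ g ⇄ f ⟩ (actP ⟨ f ⇄ a ⟩ L) ≐ actP ⟨ g ⇄ a′ ⟩ L′
    gfK≐ga′L′ = ActP.absEq-any fK≈a′L′ g (g∉ ∘ there ∘ there ∘ there ∘ ∈-++⁺ʳ S ∘ ∈-++⁺ʳ S′)
                  (g∉ ∘ there ∘ here) (g∉ ∘ there ∘ there ∘ here)
    gfK≐gaL : actP ⟨ g ⇄ f ⟩ (actP ⟨ f ⇄ a ⟩ L) ≐ actP ⟨ g ⇄ a ⟩ L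
    gfK≐gaL = ActP.≈-trans (ActP.α-ext ⟨ g ⇄ f ⟩ ⟨ f ⇄ g ⟩ (swap-comm g f) (actP ⟨ f ⇄ a ⟩ L))
                (ActP.swap-rename S-supp f∉S g∉S (f≢a ∘ sym) (g∉ ∘ here ∘ sym))
    aL≈a′L′ : AbsEq actP _≐_ a L a′ L′
    aL≈a′L′ = g , g∉ ∘ here , g∉ ∘ there ∘ there ∘ here , (S , S-supp , g∉S) ,
              (S′ , S′-supp , g∉ ∘ there ∘ there ∘ there ∘ ∈-++⁺ʳ S ∘ ∈-++⁺ˡ) ,
              ActP.≈-trans (ActP.≈-sym gfK≐gaL) gfK≐ga′L′

  absF-rename : ∀ {n} {a f S} {L : Sub (Lvl n) n} → Supports actP _≐_ S L → f ∉ S → f ≢ a →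
                absF a L ≐ absF f (actP ⟨ f ⇄ a ⟩ L)
  absF-rename {n} {a} {f} {S} {L} S-supp f∉S f≢a p =
    absF-rename⊇ (ActP.supports-α S-supp ⟨ f ⇄ a ⟩) a∉fS (f≢a ∘ sym) p ∘ absF-mono a L≐afK p ,
    absF-rename⊇ S-supp f∉S f≢a p
    where
    L≐afK : L ≐ actP ⟨ a ⇄ f ⟩ (actP ⟨ f ⇄ a ⟩ L)
    L≐afK = ActP.≈-sym (ActP.≈-trans
              (ActP.α-ext ⟨ a ⇄ f ⟩ ⟨ f ⇄ a ⟩ (swap-comm a f) (actP ⟨ f ⇄ a ⟩ L))
              (ActP.α-inverseˡ {n = n} ⟨ f ⇄ a ⟩ L))
    a∉fS : a ∉ map ⟦ ⟨ f ⇄ a ⟩ ⟧ S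
    a∉fS = ⟦⟧-∉-map ⟨ f ⇄ a ⟩ f∉S ∘ subst (_∈ map ⟦ ⟨ f ⇄ a ⟩ ⟧ S) (sym (swap-left f a))

  infix 4 _≈[_]_

  _≈[_]_ : Term V → ℕ → Term V → Set₁
  t ≈[ n ] u = Derivable X n t u

  module ≈-Reasoning {n : ℕ} where
    open import Relation.Binary.Reasoning.Base.Partial (_≈[ n ]_) ⊢-trans public
    open ReasoningSyntax.≈-syntax _IsRelatedTo_ _IsRelatedTo_ ∼-go ⊢-sym public

  ⊢-reflexive : ∀ {t n} → Depth t n → t ≈[ n ] t
  ⊢-reflexive (d-var x) = ⊢-refl x
  ⊢-reflexive (d-0 n) = cong-0 n
  ⊢-reflexive (d-⊕ dt du) = cong-⊕ (⊢-reflexive dt) (⊢-reflexive du)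
  ⊢-reflexive (d-pre a dt) = cong-pre a (⊢-reflexive dt)
  ⊢-reflexive (d-abs a dt) = cong-abs a (⊢-reflexive dt)

  -- An axiom over an orbit-finite Y is instantiated at three terms of depth l by taking Y to be
  -- three copies of the set of placements of the names of those terms; variable i at the
  -- placement v is sent to the i-th term with its names moved to v.
  module AxiomInstance {l} {t₀ t₁ t₂ : Term V}
                       (d₀ : Depth t₀ l) (d₁ : Depth t₁ l) (d₂ : Depth t₂ l) where

    term : Fin 3 → Term V
    term zero = t₀
    term (suc zero) = t₁
    term (suc (suc zero)) = t₂

    base : List 𝔸
    base = deduplicate _≟_ (supp t₀ ++ supp t₁ ++ supp t₂)

    supp⊆base : ∀ i {c} → c ∈ supp (term i) → c ∈ base
    supp⊆base zero = ∈-deduplicate⁺ _≟_ ∘ ∈-++⁺ˡ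
    supp⊆base (suc zero) = ∈-deduplicate⁺ _≟_ ∘ ∈-++⁺ʳ (supp t₀) ∘ ∈-++⁺ˡ
    supp⊆base (suc (suc zero)) = ∈-deduplicate⁺ _≟_ ∘ ∈-++⁺ʳ (supp t₀) ∘ ∈-++⁺ʳ (supp t₁)

    Placed : List 𝔸 → Set
    Placed v = True (unique? v) × length v ≡ length base

    Placement : Set
    Placement = Σ (List 𝔸) Placed

    placement-≡ : ∀ {v v′} {p : Placed v} {p′ : Placed v′} → v ≡ v′ →
                  _≡_ {A = Placement} (v , p) (v′ , p′)
    placement-≡ {p = u , l} {u′ , l′} refl =
      cong₂ (λ u l → _ , u , l) (T-irrelevant u u′) (≡-irrelevant l l′)

    placed-map : ∀ π {v} → Placed v → Placed (map ⟦ π ⟧ v)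
    placed-map π {v} (v-unique , |v|≡) =
      fromWitness (Unique.map⁺ (⟦⟧-injective π) (toWitness v-unique)) ,
      trans (length-map ⟦ π ⟧ v) |v|≡

    Y : Nominal
    Y = record
      { Carrier = Fin 3 × Placement
      ; act = λ { π (i , v , p) → i , map ⟦ π ⟧ v , placed-map π p }
      ; act-id = λ { (i , v , p) → cong (i ,_) (placement-≡ (map-id v)) }
      ; act-comp = λ { π σ (i , v , p) →
                       cong (i ,_) (placement-≡ (trans (map-cong (⟦⟧-++ π σ) v) (map-∘ v))) }
      ; act-ext = λ { π σ π≗σ (i , v , p) → cong (i ,_) (placement-≡ (map-cong π≗σ v)) }
      ; finsupp = λ { (i , v , p) →
                      v , λ π π-fixes → cong (i ,_) (placement-≡ (map-id-local (All.tabulate (π-fixes _)))) }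
      }

    base-placed : Placed base
    base-placed = fromWitness (deduplicate-! _≟_ _) , refl

    generator : Fin 3 → Carrier Y
    generator i = i , base , base-placed

    relabel-base : ∀ {v} → Placed v → map ⟦ relabel base v ⟧ base ≡ v
    relabel-base (v-unique , |v|≡) =
      relabel-maps base _ (toWitness (proj₁ base-placed)) (toWitness v-unique) |v|≡

    Y-orbitFinite : OrbitFinite Y
    Y-orbitFinite =
      map generator (allFin 3) , λ { (i , v , p) → lose (∈-map⁺ generator (∈-allFin i)) (orbit i v p) }
      where
      orbit : ∀ i v p → ∃ λ π → act Y π (generator i) ≡ (i , v , p)
      orbit i v p = relabel base v , cong (i ,_) (placement-≡ (relabel-base p))

    σ : Carrier Y → Term V
    σ (i , v , _) = actT (act X) (relabel base v) (term i)

    σ-depth : ∀ y → Depth (σ y) l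
    σ-depth (zero , v , _) = Depth-act (relabel base v) d₀
    σ-depth (suc zero , v , _) = Depth-act (relabel base v) d₁
    σ-depth (suc (suc zero) , v , _) = Depth-act (relabel base v) d₂

    σ-equivariant : ∀ π y → actT (act X) π (σ y) ≡ σ (act Y π y)
    σ-equivariant π (i , v , p) =
      trans (actT-++ π (relabel base v) (term i))
            (ActT.α-agree-on-support (supp-supports (term i)) _ _ (λ c → agree ∘ supp⊆base i))
      where
      agree : ∀ {c} → c ∈ base → ⟦ π ++ relabel base v ⟧ c ≡ ⟦ relabel base (map ⟦ π ⟧ v) ⟧ c
      agree {c} = map-≡⇒agree base (begin
        map ⟦ π ++ relabel base v ⟧ base           ≡⟨ map-cong (⟦⟧-++ π _) base ⟩
        map (⟦ π ⟧ ∘ ⟦ relabel base v ⟧) base      ≡⟨ map-∘ base ⟩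
        map ⟦ π ⟧ (map ⟦ relabel base v ⟧ base)    ≡⟨ cong (map ⟦ π ⟧) (relabel-base p) ⟩
        map ⟦ π ⟧ v                                ≡⟨ relabel-base (placed-map π p) ⟨
        map ⟦ relabel base (map ⟦ π ⟧ v) ⟧ base    ∎)
        where open ≡-Reasoning

    σ-generator : ∀ i → σ (act Y [] (generator i)) ≡ term i
    σ-generator i = trans (cong (λ v → actT (act X) (relabel base v) (term i)) (map-id base))
                          (supp-supports (term i) (relabel base base) fixes)
      where
      fixes : Fixes (relabel base base) (supp (term i))
      fixes c c∈ = map-≡⇒agree base (trans (relabel-base base-placed) (sym (map-id base))) (supp⊆base i c∈)

    axiom-instance : ∀ {m r s} → Ax Y m r s →
                     substitute σ (actT (act Y) [] r) ≈[ m + l ] substitute σ (actT (act Y) [] s)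
    axiom-instance axiom = ax Y Y-orbitFinite axiom [] l σ σ-depth
      (λ π y → subst (actT (act X) π (σ y) ≈[ l ]_) (σ-equivariant π y)
                     (⊢-reflexive (Depth-act π (σ-depth y))))

    private
      y₀ = generator zero
      y₁ = generator (suc zero)
      y₂ = generator (suc (suc zero))
      σy₀ = σ-generator zero
      σy₁ = σ-generator (suc zero)
      σy₂ = σ-generator (suc (suc zero))

    ⊕-identityʳ : t₀ ⊕ `0 ≈[ l ] t₀
    ⊕-identityʳ = subst₂ _≈[ l ]_ (cong (_⊕ `0) σy₀) σy₀ (axiom-instance (ax-unit y₀))

    ⊕-idem : t₀ ⊕ t₀ ≈[ l ] t₀
    ⊕-idem = subst₂ _≈[ l ]_ (cong₂ _⊕_ σy₀ σy₀) σy₀ (axiom-instance (ax-idem y₀))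

    ⊕-comm : t₀ ⊕ t₁ ≈[ l ] t₁ ⊕ t₀
    ⊕-comm = subst₂ _≈[ l ]_ (cong₂ _⊕_ σy₀ σy₁) (cong₂ _⊕_ σy₁ σy₀) (axiom-instance (ax-comm y₀ y₁))

    ⊕-assoc : (t₀ ⊕ t₁) ⊕ t₂ ≈[ l ] t₀ ⊕ (t₁ ⊕ t₂)
    ⊕-assoc = subst₂ _≈[ l ]_ (cong₂ _⊕_ (cong₂ _⊕_ σy₀ σy₁) σy₂)
                              (cong₂ _⊕_ σy₀ (cong₂ _⊕_ σy₁ σy₂))
                              (axiom-instance (ax-assoc y₀ y₁ y₂))

    pre-distrib-⊕ : ∀ a → pre a (t₀ ⊕ t₁) ≈[ suc l ] pre a t₀ ⊕ pre a t₁
    pre-distrib-⊕ a = subst₂ _≈[ suc l ]_ (cong (pre a) (cong₂ _⊕_ σy₀ σy₁))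
                                          (cong₂ _⊕_ (cong (pre a) σy₀) (cong (pre a) σy₁))
                                          (axiom-instance (ax-pre⊕ a y₀ y₁))

    abs-distrib-⊕ : ∀ a → abs a (t₀ ⊕ t₁) ≈[ suc l ] abs a t₀ ⊕ abs a t₁
    abs-distrib-⊕ a = subst₂ _≈[ suc l ]_ (cong (abs a) (cong₂ _⊕_ σy₀ σy₁))
                                          (cong₂ _⊕_ (cong (abs a) σy₀) (cong (abs a) σy₁))
                                          (axiom-instance (ax-abs⊕ a y₀ y₁))

    pre-absorbed : ∀ a → pre a t₀ ⊕ abs a t₀ ≈[ suc l ] abs a t₀
    pre-absorbed a = subst₂ _≈[ suc l ]_ (cong₂ _⊕_ (cong (pre a) σy₀) (cong (abs a) σy₀))
                                         (cong (abs a) σy₀)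
                                         (axiom-instance (ax-preabs a y₀))

  ⊕-identityʳ : ∀ {l t} → Depth t l → t ⊕ `0 ≈[ l ] t
  ⊕-identityʳ dt = AxiomInstance.⊕-identityʳ dt dt dt

  ⊕-idem : ∀ {l t} → Depth t l → t ⊕ t ≈[ l ] t
  ⊕-idem dt = AxiomInstance.⊕-idem dt dt dt

  ⊕-comm : ∀ {l t u} → Depth t l → Depth u l → t ⊕ u ≈[ l ] u ⊕ t
  ⊕-comm dt du = AxiomInstance.⊕-comm dt du dt

  ⊕-assoc : ∀ {l t u w} → Depth t l → Depth u l → Depth w l → (t ⊕ u) ⊕ w ≈[ l ] t ⊕ (u ⊕ w)
  ⊕-assoc = AxiomInstance.⊕-assoc

  pre-distrib-⊕ : ∀ {l t u} a → Depth t l → Depth u l →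
                  pre a (t ⊕ u) ≈[ suc l ] pre a t ⊕ pre a u
  pre-distrib-⊕ a dt du = AxiomInstance.pre-distrib-⊕ dt du dt a

  abs-distrib-⊕ : ∀ {l t u} a → Depth t l → Depth u l →
                  abs a (t ⊕ u) ≈[ suc l ] abs a t ⊕ abs a u
  abs-distrib-⊕ a dt du = AxiomInstance.abs-distrib-⊕ dt du dt a

  pre-absorbed : ∀ {l t} a → Depth t l → pre a t ⊕ abs a t ≈[ suc l ] abs a t
  pre-absorbed a dt = AxiomInstance.pre-absorbed dt dt dt a

  ∅-orbitFinite : OrbitFinite ∅N
  ∅-orbitFinite = [] , λ ()

  pre-zero : ∀ a l → pre a `0 ≈[ suc l ] `0
  pre-zero a l = ax ∅N ∅-orbitFinite (ax-pre0 a) [] l (λ ()) (λ ()) (λ _ ())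

  abs-zero : ∀ a l → abs a `0 ≈[ suc l ] `0
  abs-zero a l = ax ∅N ∅-orbitFinite (ax-abs0 a) [] l (λ ()) (λ ()) (λ _ ())

  -- The semilattice order

  infix 4 _≤[_]_

  _≤[_]_ : Term V → ℕ → Term V → Set₁
  t ≤[ n ] u = t ⊕ u ≈[ n ] u

  module _ {n : ℕ} {t u : Term V} (dt : Depth t n) (du : Depth u n) where
    open ≈-Reasoning

    ≤-antisym : t ≤[ n ] u → u ≤[ n ] t → t ≈[ n ] u
    ≤-antisym t≤u u≤t = begin
      t      ≈⟨ u≤t ⟨
      u ⊕ t  ≈⟨ ⊕-comm du dt ⟩
      t ⊕ u  ≈⟨ t≤u ⟩
      u      ∎

    pre-mono-≤ : ∀ a → t ≤[ n ] u → pre a t ≤[ suc n ] pre a u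
    pre-mono-≤ a t≤u = ⊢-trans (⊢-sym (pre-distrib-⊕ a dt du)) (cong-pre a t≤u)

    abs-mono-≤ : ∀ a → t ≤[ n ] u → abs a t ≤[ suc n ] abs a u
    abs-mono-≤ a t≤u = ⊢-trans (⊢-sym (abs-distrib-⊕ a dt du)) (cong-abs a t≤u)

  module _ {n : ℕ} {t k u : Term V} (dt : Depth t n) (dk : Depth k n) (du : Depth u n) where
    open ≈-Reasoning

    ≤-trans : t ≤[ n ] k → k ≤[ n ] u → t ≤[ n ] u
    ≤-trans t≤k k≤u = begin
      t ⊕ u        ≈⟨ cong-⊕ (⊢-reflexive dt) k≤u ⟨
      t ⊕ (k ⊕ u)  ≈⟨ ⊕-assoc dt dk du ⟨
      (t ⊕ k) ⊕ u  ≈⟨ cong-⊕ t≤k (⊢-reflexive du) ⟩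
      k ⊕ u        ≈⟨ k≤u ⟩
      u            ∎

    ⊕-lub : t ≤[ n ] u → k ≤[ n ] u → t ⊕ k ≤[ n ] u
    ⊕-lub t≤u k≤u = begin
      (t ⊕ k) ⊕ u  ≈⟨ ⊕-assoc dt dk du ⟩
      t ⊕ (k ⊕ u)  ≈⟨ cong-⊕ (⊢-reflexive dt) k≤u ⟩
      t ⊕ u        ≈⟨ t≤u ⟩
      u            ∎

    ≤-⊕ˡ : t ≤[ n ] k → t ≤[ n ] k ⊕ u
    ≤-⊕ˡ t≤k = begin
      t ⊕ (k ⊕ u)  ≈⟨ ⊕-assoc dt dk du ⟨
      (t ⊕ k) ⊕ u  ≈⟨ cong-⊕ t≤k (⊢-reflexive du) ⟩
      k ⊕ u        ∎

    ≤-⊕ʳ : t ≤[ n ] u → t ≤[ n ] k ⊕ u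
    ≤-⊕ʳ t≤u = begin
      t ⊕ (k ⊕ u)  ≈⟨ cong-⊕ (⊢-reflexive dt) (⊕-comm dk du) ⟩
      t ⊕ (u ⊕ k)  ≈⟨ ⊕-assoc dt du dk ⟨
      (t ⊕ u) ⊕ k  ≈⟨ cong-⊕ t≤u (⊢-reflexive dk) ⟩
      u ⊕ k        ≈⟨ ⊕-comm du dk ⟩
      k ⊕ u        ∎

  ≤-respˡ-≈ : ∀ {n t t′ u} → Depth u n → t ≈[ n ] t′ → t′ ≤[ n ] u → t ≤[ n ] u
  ≤-respˡ-≈ du t≈t′ t′≤u = ⊢-trans (cong-⊕ t≈t′ (⊢-reflexive du)) t′≤u

  ≤-respʳ-≈ : ∀ {n t u u′} → Depth t n → t ≤[ n ] u → u ≈[ n ] u′ → t ≤[ n ] u′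
  ≤-respʳ-≈ {n} {t} {u} {u′} dt t≤u u≈u′ = begin
    t ⊕ u′  ≈⟨ cong-⊕ (⊢-reflexive dt) u≈u′ ⟨
    t ⊕ u   ≈⟨ t≤u ⟩
    u       ≈⟨ u≈u′ ⟩
    u′      ∎
    where open ≈-Reasoning

  0≤ : ∀ {n u} → Depth u n → `0 ≤[ n ] u
  0≤ {n} du = ⊢-trans (⊕-comm (d-0 n) du) (⊕-identityʳ du)

  -- Monomials

  data Monomial : Term V → ℕ → Set where
    mvar : ∀ x → Monomial (var x) 0
    mpre : ∀ {m n} a → Monomial m n → Monomial (pre a m) (suc n)
    mabs : ∀ {m n} a → Monomial m n → Monomial (abs a m) (suc n)

  Monomial-depth : ∀ {m n} → Monomial m n → Depth m n
  Monomial-depth (mvar x) = d-var x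
  Monomial-depth (mpre a mm) = d-pre a (Monomial-depth mm)
  Monomial-depth (mabs a mm) = d-abs a (Monomial-depth mm)

  Monomial-act : ∀ π {m n} → Monomial m n → Monomial (actT (act X) π m) n
  Monomial-act π (mvar x) = mvar _
  Monomial-act π (mpre a mm) = mpre _ (Monomial-act π mm)
  Monomial-act π (mabs a mm) = mabs _ (Monomial-act π mm)

  cons : ∀ {n} → 𝔸 → Elt n → Elt (suc n)
  cons a (v , x) = a ∷ v , x

  word : ∀ {m n} → Monomial m n → Elt n
  word (mvar x) = [] , x
  word (mpre a mm) = cons a (word mm)
  word (mabs a mm) = cons a (word mm)

  word-act : ∀ π {m n} (mm : Monomial m n) → word (Monomial-act π mm) ≡ actE π (word mm)
  word-act π (mvar x) = refl
  word-act π (mpre a mm) = cong (cons (⟦ π ⟧ a)) (word-act π mm)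
  word-act π (mabs a mm) = cong (cons (⟦ π ⟧ a)) (word-act π mm)

  word-supported : ∀ {m n} (mm : Monomial m n) → Supports actE _≡_ (supp m) (word mm)
  word-supported (mvar x) π π-fixes = cong ([] ,_) (proj₂ (finsupp X x) π π-fixes)
  word-supported (mpre a mm) π π-fixes =
    cong₂ cons (π-fixes a (here refl)) (word-supported mm π (λ b → π-fixes b ∘ there))
  word-supported (mabs a mm) π π-fixes =
    cong₂ cons (π-fixes a (here refl)) (word-supported mm π (λ b → π-fixes b ∘ there))

  names : Term V → List 𝔸
  names (var x) = []
  names `0 = []
  names (t ⊕ u) = names t ++ names u
  names (pre a t) = a ∷ names t
  names (abs a t) = a ∷ names t

  bound : Term V → List 𝔸
  bound (var x) = []
  bound `0 = []
  bound (t ⊕ u) = bound t ++ bound u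
  bound (pre a t) = bound t
  bound (abs a t) = a ∷ bound t

  NoRebinding : Term V → Set
  NoRebinding (var x) = ⊤
  NoRebinding `0 = ⊤
  NoRebinding (t ⊕ u) = NoRebinding t × NoRebinding u
  NoRebinding (pre a t) = a ∉ bound t × NoRebinding t
  NoRebinding (abs a t) = a ∉ bound t × NoRebinding t

  names-act : ∀ π t → names (actT (act X) π t) ≡ map ⟦ π ⟧ (names t)
  names-act π (var x) = refl
  names-act π `0 = refl
  names-act π (t ⊕ u) =
    trans (cong₂ _++_ (names-act π t) (names-act π u)) (sym (map-++ ⟦ π ⟧ (names t) (names u)))
  names-act π (pre a t) = cong (⟦ π ⟧ a ∷_) (names-act π t)
  names-act π (abs a t) = cong (⟦ π ⟧ a ∷_) (names-act π t)

  bound-act : ∀ π t → bound (actT (act X) π t) ≡ map ⟦ π ⟧ (bound t)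
  bound-act π (var x) = refl
  bound-act π `0 = refl
  bound-act π (t ⊕ u) =
    trans (cong₂ _++_ (bound-act π t) (bound-act π u)) (sym (map-++ ⟦ π ⟧ (bound t) (bound u)))
  bound-act π (pre a t) = bound-act π t
  bound-act π (abs a t) = cong (⟦ π ⟧ a ∷_) (bound-act π t)

  bound-swap-id : ∀ {f a} t → f ∉ bound t → a ∉ bound t →
                  bound (actT (act X) ⟨ f ⇄ a ⟩ t) ≡ bound t
  bound-swap-id t f∉ a∉ = trans (bound-act _ t) (map-swap-id f∉ a∉)

  ∉-bound-act : ∀ π {a} t → a ∉ bound t → ⟦ π ⟧ a ∉ bound (actT (act X) π t)
  ∉-bound-act π t a∉ = ⟦⟧-∉-map π a∉ ∘ subst (_ ∈_) (bound-act π t)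

  NoRebinding-act : ∀ π t → NoRebinding t → NoRebinding (actT (act X) π t)
  NoRebinding-act π (var x) _ = tt
  NoRebinding-act π `0 _ = tt
  NoRebinding-act π (t ⊕ u) (nr-t , nr-u) = NoRebinding-act π t nr-t , NoRebinding-act π u nr-u
  NoRebinding-act π (pre a t) (a∉ , nr) = ∉-bound-act π t a∉ , NoRebinding-act π t nr
  NoRebinding-act π (abs a t) (a∉ , nr) = ∉-bound-act π t a∉ , NoRebinding-act π t nr

  bound⊆supp : ∀ t {c} → c ∈ bound t → c ∈ supp t
  bound⊆supp (t ⊕ u) c∈ with ∈-++⁻ (bound t) c∈
  ... | inj₁ c∈t = ∈-++⁺ˡ (bound⊆supp t c∈t)
  ... | inj₂ c∈u = ∈-++⁺ʳ (supp t) (bound⊆supp u c∈u)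
  bound⊆supp (pre a t) c∈ = there (bound⊆supp t c∈)
  bound⊆supp (abs a t) (here c≡a) = here c≡a
  bound⊆supp (abs a t) (there c∈) = there (bound⊆supp t c∈)

  abs-rename : ∀ {n t g a} → g ≢ a → Depth t n → g ∉ supp t →
               abs g (actT (act X) ⟨ g ⇄ a ⟩ t) ≈[ suc n ] abs a t
  abs-rename {t = t} g≢a dt g∉t = perm _ _ (⊢-reflexive (Depth-act _ dt)) g≢a (supp-fresh t g∉t)

  Disjoint-rename : ∀ {g a b} m u → g ∉ bound m → b ∉ bound m → Disjoint (bound m) (names (abs a u)) →
                    Disjoint (bound (actT (act X) ⟨ g ⇄ b ⟩ m)) (names (actT (act X) ⟨ g ⇄ a ⟩ u))
  Disjoint-rename {g} {a} {b} m u g∉m b∉m apart {c} (c∈gbm , c∈gau) =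
    apart (c∈m , there (∈-map-swap⁻ (subst (c ∈_) (names-act ⟨ g ⇄ a ⟩ u) c∈gau) c≢g c≢a))
    where
    c∈m : c ∈ bound m
    c∈m = subst (c ∈_) (bound-swap-id m g∉m b∉m) c∈gbm
    c≢g : c ≢ g
    c≢g c≡g = g∉m (subst (_∈ _) c≡g c∈m)
    c≢a : c ≢ a
    c≢a c≡a = apart (c∈m , here c≡a)

  mutual
    monomial-≤ : ∀ {n m u} (mm : Monomial m n) (du : Depth u n) → NoRebinding m →
                 Disjoint (bound m) (names u) → e du (word mm) → m ≤[ n ] u
    monomial-≤ mm (d-0 _) _ _ (lift ())
    monomial-≤ mm (d-⊕ du₁ du₂) nr apart (inj₁ w∈) =
      ≤-⊕ˡ (Monomial-depth mm) du₁ du₂ (monomial-≤ mm du₁ nr (apart ∘ Prod.map₂ ∈-++⁺ˡ) w∈)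
    monomial-≤ mm (d-⊕ {u₁} du₁ du₂) nr apart (inj₂ w∈) =
      ≤-⊕ʳ (Monomial-depth mm) du₁ du₂
        (monomial-≤ mm du₂ nr (apart ∘ Prod.map₂ (∈-++⁺ʳ (names u₁))) w∈)
    monomial-≤ (mvar x) (d-var .x) _ _ refl = ⊕-idem (d-var x)
    monomial-≤ (mpre b mm) (d-pre .b du) (_ , nr) apart (lift (refl , w∈)) =
      pre-mono-≤ (Monomial-depth mm) du b (monomial-≤ mm du nr (apart ∘ Prod.map₂ there) w∈)
    monomial-≤ (mabs b mm) (d-pre .b du) _ apart (lift (refl , _)) =
      ⊥-elim (apart (here refl , here refl))
    monomial-≤ (mpre b mm) (d-abs a du) (b∉ , nr) apart w∈ =
      ≤-trans (d-pre b dm) (d-abs b dm) (d-abs a du)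
        (pre-absorbed b dm) (abs-monomial-≤ mm du b∉ nr apart w∈)
      where dm = Monomial-depth mm
    monomial-≤ (mabs b mm) (d-abs a du) (b∉ , nr) apart w∈ =
      abs-monomial-≤ mm du b∉ nr (apart ∘ Prod.map₁ there) w∈

    abs-monomial-≤ : ∀ {n m u a b} (mm : Monomial m n) (du : Depth u n) → b ∉ bound m →
                     NoRebinding m → Disjoint (bound m) (names (abs a u)) →
                     absF a (e du) (cons b (word mm)) → abs b m ≤[ suc n ] abs a u
    abs-monomial-≤ {n} {m} {u} {a} {b} mm du b∉ nr apart w∈ =
      ≤-respˡ-≈ (d-abs a du) (⊢-sym (abs-rename g≢b (Monomial-depth mm) g∉m))
        (≤-respʳ-≈ (d-abs g (Monomial-depth mm′)) (abs-mono-≤ (Monomial-depth mm′) du′ g gbm≤gau)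
          (abs-rename g≢a du g∉u))
      where
      avoid = a ∷ b ∷ supp u ++ supp m
      g = fresh avoid
      g∉ = fresh-∉ avoid
      g≢a : g ≢ a
      g≢a = g∉ ∘ here
      g≢b : g ≢ b
      g≢b = g∉ ∘ there ∘ here
      g∉u : g ∉ supp u
      g∉u = g∉ ∘ there ∘ there ∘ ∈-++⁺ˡ
      g∉m : g ∉ supp m
      g∉m = g∉ ∘ there ∘ there ∘ ∈-++⁺ʳ (supp u)
      mm′ = Monomial-act ⟨ g ⇄ b ⟩ mm
      du′ = Depth-act ⟨ g ⇄ a ⟩ du
      w′∈ : e du′ (word mm′)
      w′∈ = subst (e du′) (sym (word-act ⟨ g ⇄ b ⟩ mm))
              (proj₂ (e-equivariant ⟨ g ⇄ a ⟩ du _)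
                (absF-elim (e-supported du) (word-supported mm) (g∉ ∘ there ∘ there) g≢a g≢b w∈))
      gbm≤gau : actT (act X) ⟨ g ⇄ b ⟩ m ≤[ n ] actT (act X) ⟨ g ⇄ a ⟩ u
      gbm≤gau = monomial-≤ mm′ du′ (NoRebinding-act ⟨ g ⇄ b ⟩ m nr)
                  (Disjoint-rename m u (g∉m ∘ bound⊆supp m) b∉ apart) w′∈

  -- Normal forms

  MonomialTerm : ℕ → Set
  MonomialTerm n = Σ (Term V) λ m → Monomial m n

  ∑ : ∀ {n} → List (MonomialTerm n) → Term V
  ∑ [] = `0
  ∑ ((m , _) ∷ ms) = m ⊕ ∑ ms

  ∑-depth : ∀ {n} (ms : List (MonomialTerm n)) → Depth (∑ ms) n
  ∑-depth {n} [] = d-0 n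
  ∑-depth ((_ , mm) ∷ ms) = d-⊕ (Monomial-depth mm) (∑-depth ms)

  ∑-++ : ∀ {n} (ms ns : List (MonomialTerm n)) → ∑ ms ⊕ ∑ ns ≈[ n ] ∑ (ms ++ ns)
  ∑-++ [] ns = 0≤ (∑-depth ns)
  ∑-++ ((_ , mm) ∷ ms) ns =
    ⊢-trans (⊕-assoc (Monomial-depth mm) (∑-depth ms) (∑-depth ns))
            (cong-⊕ (⊢-reflexive (Monomial-depth mm)) (∑-++ ms ns))

  preM : ∀ {n} → 𝔸 → MonomialTerm n → MonomialTerm (suc n)
  preM a (m , mm) = pre a m , mpre a mm

  absM : ∀ {n} → 𝔸 → MonomialTerm n → MonomialTerm (suc n)
  absM a (m , mm) = abs a m , mabs a mm

  ∑-pre : ∀ {n} a (ms : List (MonomialTerm n)) → pre a (∑ ms) ≈[ suc n ] ∑ (map (preM a) ms)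
  ∑-pre {n} a [] = pre-zero a n
  ∑-pre a ((_ , mm) ∷ ms) =
    ⊢-trans (pre-distrib-⊕ a (Monomial-depth mm) (∑-depth ms))
            (cong-⊕ (⊢-reflexive (d-pre a (Monomial-depth mm))) (∑-pre a ms))

  ∑-abs : ∀ {n} a (ms : List (MonomialTerm n)) → abs a (∑ ms) ≈[ suc n ] ∑ (map (absM a) ms)
  ∑-abs {n} a [] = abs-zero a n
  ∑-abs a ((_ , mm) ∷ ms) =
    ⊢-trans (abs-distrib-⊕ a (Monomial-depth mm) (∑-depth ms))
            (cong-⊕ (⊢-reflexive (d-abs a (Monomial-depth mm))) (∑-abs a ms))

  record Summand {t n} (dt : Depth t n) (mt : MonomialTerm n) : Set (Lvl n) where
    field
      word∈ : e dt (word (proj₂ mt))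
      noRebinding : NoRebinding t → NoRebinding (proj₁ mt)
      bound⊆ : ∀ {c} → c ∈ bound (proj₁ mt) → c ∈ bound t

  record NormalForm {t n} (dt : Depth t n) : Set (lsuc (Lvl n)) where
    field
      monomials : List (MonomialTerm n)
      ≈∑ : t ≈[ n ] ∑ monomials
      summands : All (Summand dt) monomials

  module _ {n} {t₁ t₂ : Term V} {dt₁ : Depth t₁ n} {dt₂ : Depth t₂ n} {mt : MonomialTerm n} where
    open Summand

    Summand-⊕ˡ : Summand dt₁ mt → Summand (d-⊕ dt₁ dt₂) mt
    Summand-⊕ˡ s = record
      { word∈ = inj₁ (word∈ s) ; noRebinding = noRebinding s ∘ proj₁ ; bound⊆ = ∈-++⁺ˡ ∘ bound⊆ s }

    Summand-⊕ʳ : Summand dt₂ mt → Summand (d-⊕ dt₁ dt₂) mt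
    Summand-⊕ʳ s = record
      { word∈ = inj₂ (word∈ s) ; noRebinding = noRebinding s ∘ proj₂ ; bound⊆ = ∈-++⁺ʳ (bound t₁) ∘ bound⊆ s }

  module _ {n} {t : Term V} {dt : Depth t n} {mt : MonomialTerm n} (a : 𝔸) where
    open Summand

    Summand-pre : Summand dt mt → Summand (d-pre a dt) (preM a mt)
    Summand-pre s = record
      { word∈ = lift (refl , word∈ s)
      ; noRebinding = Prod.map (_∘ bound⊆ s) (noRebinding s)
      ; bound⊆ = bound⊆ s
      }

    Summand-abs : Summand dt mt → Summand (d-abs a dt) (absM a mt)
    Summand-abs s = record
      { word∈ = absF-intro a (e-supported dt) (word∈ s)
      ; noRebinding = Prod.map (_∘ bound⊆ s) (noRebinding s)
      ; bound⊆ = λ { (here c≡a) → here c≡a ; (there c∈) → there (bound⊆ s c∈) }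
      }

  normal-form : ∀ {t n} (dt : Depth t n) → NormalForm dt
  normal-form (d-var x) = record
    { monomials = (var x , mvar x) ∷ []
    ; ≈∑ = ⊢-sym (⊕-identityʳ (d-var x))
    ; summands = record { word∈ = refl ; noRebinding = λ _ → tt ; bound⊆ = λ () } ∷ []
    }
  normal-form (d-0 n) = record { monomials = [] ; ≈∑ = cong-0 n ; summands = [] }
  normal-form (d-⊕ dt₁ dt₂) = record
    { monomials = monomials nf₁ ++ monomials nf₂
    ; ≈∑ = ⊢-trans (cong-⊕ (≈∑ nf₁) (≈∑ nf₂)) (∑-++ (monomials nf₁) (monomials nf₂))
    ; summands = All.++⁺ (All.map Summand-⊕ˡ (summands nf₁)) (All.map Summand-⊕ʳ (summands nf₂))
    }
    where
    open NormalForm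
    nf₁ = normal-form dt₁
    nf₂ = normal-form dt₂
  normal-form (d-pre a dt) = record
    { monomials = map (preM a) (monomials nf)
    ; ≈∑ = ⊢-trans (cong-pre a (≈∑ nf)) (∑-pre a (monomials nf))
    ; summands = All.map⁺ (All.map (Summand-pre a) (summands nf))
    }
    where
    open NormalForm
    nf = normal-form dt
  normal-form (d-abs a dt) = record
    { monomials = map (absM a) (monomials nf)
    ; ≈∑ = ⊢-trans (cong-abs a (≈∑ nf)) (∑-abs a (monomials nf))
    ; summands = All.map⁺ (All.map (Summand-abs a) (summands nf))
    }
    where
    open NormalForm
    nf = normal-form dt

  record BinderRenaming (S : List 𝔸) {t n} (dt : Depth t n) : Set (lsuc (Lvl n)) where
    field
      {term} : Term V
      depth : Depth term n
      ≈term : t ≈[ n ] term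
      e≐ : e dt ≐ e depth
      noRebinding : NoRebinding term
      apart : Disjoint (bound term) S

  module _ {S : List 𝔸} where
    open BinderRenaming

    BinderRenaming-⊕ : ∀ {n t₁ t₂} {dt₁ : Depth t₁ n} {dt₂ : Depth t₂ n} →
                       BinderRenaming S dt₁ → BinderRenaming S dt₂ → BinderRenaming S (d-⊕ dt₁ dt₂)
    BinderRenaming-⊕ r₁ r₂ = record
      { depth = d-⊕ (depth r₁) (depth r₂)
      ; ≈term = cong-⊕ (≈term r₁) (≈term r₂)
      ; e≐ = unionF-cong (e≐ r₁) (e≐ r₂)
      ; noRebinding = noRebinding r₁ , noRebinding r₂
      ; apart = λ (c∈ , c∈S) → Sum.[ (λ c∈₁ → apart r₁ (c∈₁ , c∈S)) , (λ c∈₂ → apart r₂ (c∈₂ , c∈S)) ]′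
                                   (∈-++⁻ (bound (term r₁)) c∈)
      }

    BinderRenaming-pre : ∀ {n t} {dt : Depth t n} a → BinderRenaming (a ∷ S) dt →
                         BinderRenaming S (d-pre a dt)
    BinderRenaming-pre a r = record
      { depth = d-pre a (depth r)
      ; ≈term = cong-pre a (≈term r)
      ; e≐ = preF-cong a (e≐ r)
      ; noRebinding = (λ a∈ → apart r (a∈ , here refl)) , noRebinding r
      ; apart = λ (c∈ , c∈S) → apart r (c∈ , there c∈S)
      }

    BinderRenaming-abs : ∀ {n t} {dt : Depth t n} a → BinderRenaming (a ∷ S) dt →
                         BinderRenaming S (d-abs a dt)
    BinderRenaming-abs a r = record
      { depth = d-abs f (Depth-act fa (depth r))
      ; ≈term = ⊢-trans (cong-abs a (≈term r)) (⊢-sym (abs-rename f≢a (depth r) f∉s))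
      ; e≐ = ActP.≈-trans (absF-cong a (e≐ r))
               (ActP.≈-trans (absF-rename (e-supported (depth r)) f∉s f≢a)
                 (absF-cong f (ActP.≈-sym (e-equivariant fa (depth r)))))
      ; noRebinding = subst (f ∉_) (sym bound≡) (f∉s ∘ bound⊆supp s) ,
                      NoRebinding-act fa s (noRebinding r)
      ; apart = λ { (here refl , f∈S) → f∉S f∈S
                  ; (there c∈ , c∈S) → apart r (subst (_ ∈_) bound≡ c∈ , there c∈S) }
      }
      where
      s = term r
      avoid = a ∷ S ++ supp s
      f = fresh avoid
      fa = ⟨ f ⇄ a ⟩
      f≢a : f ≢ a
      f≢a = fresh-∉ avoid ∘ here
      f∉S : f ∉ S
      f∉S = fresh-∉ avoid ∘ there ∘ ∈-++⁺ˡ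
      f∉s : f ∉ supp s
      f∉s = fresh-∉ avoid ∘ there ∘ ∈-++⁺ʳ S
      bound≡ : bound (actT (act X) fa s) ≡ bound s
      bound≡ = bound-swap-id s (f∉s ∘ bound⊆supp s) (λ a∈ → apart r (a∈ , here refl))

  rename-binders : ∀ S {t n} (dt : Depth t n) → BinderRenaming S dt
  rename-binders S (d-var x) = record
    { depth = d-var x ; ≈term = ⊢-refl x ; e≐ = ActP.≈-refl ; noRebinding = tt ; apart = λ () }
  rename-binders S (d-0 n) = record
    { depth = d-0 n ; ≈term = cong-0 n ; e≐ = ActP.≈-refl ; noRebinding = tt ; apart = λ () }
  rename-binders S (d-⊕ dt₁ dt₂) = BinderRenaming-⊕ (rename-binders S dt₁) (rename-binders S dt₂)
  rename-binders S (d-pre a dt) = BinderRenaming-pre a (rename-binders (a ∷ S) dt)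
  rename-binders S (d-abs a dt) = BinderRenaming-abs a (rename-binders (a ∷ S) dt)

  -- Completeness

  e-⊆⇒≤ : ∀ {n t u} (dt : Depth t n) (du : Depth u n) → (∀ p → e dt p → e du p) → t ≤[ n ] u
  e-⊆⇒≤ {n} {t} {u} dt du e⊆ = ≤-respˡ-≈ du (⊢-trans (≈term r) (≈∑ nf)) (∑-≤ (summands nf))
    where
    open BinderRenaming
    open NormalForm
    r = rename-binders (names u) dt
    nf = normal-form (depth r)
    summand-≤ : ∀ {m} (mm : Monomial m n) → Summand (depth r) (m , mm) → m ≤[ n ] u
    summand-≤ mm s = monomial-≤ mm du (Summand.noRebinding s (noRebinding r))
                       (λ (c∈ , c∈u) → apart r (Summand.bound⊆ s c∈ , c∈u))
                       (e⊆ _ (proj₂ (e≐ r _) (Summand.word∈ s)))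
    ∑-≤ : ∀ {ms} → All (Summand (depth r)) ms → ∑ ms ≤[ n ] u
    ∑-≤ [] = 0≤ du
    ∑-≤ {(_ , mm) ∷ ms} (s ∷ ss) = ⊕-lub (Monomial-depth mm) (∑-depth ms) du (summand-≤ mm s) (∑-≤ ss)

lemma5 : (X : Nominal) (n : ℕ) (t u : Term (Carrier X))
         (dt : Depth t n) (du : Depth u n) →
         F′._≐_ X (F′.e X dt) (F′.e X du) →
         Derivable X n t u
lemma5 X n t u dt du e≐ =
  ≤-antisym X dt du (e-⊆⇒≤ X dt du (proj₁ ∘ e≐)) (e-⊆⇒≤ X du dt (proj₂ ∘ e≐))
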